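{- Let $k,t\ge1$ with $t$ a power of two and $k\le t/6$. Then there exists a valid perfect randomized $[t,k]$-interval system $\mathcal F$ with $$\mathrm{val}(\mathcal F)\ \le\ \frac{10\,k^2\log_2(t)}{t}.$$
   Context: An interval is a nonempty set $\{a,\dots,b\}$ of integers; a $[t,k]$-interval system is a set of $k$ pairwise disjoint intervals in $[t]$; a randomized $[t,k]$-interval system is a distribution over them. $\mathrm{Sets}(F)$: choose independently a uniform element from each interval of $F$; for randomized $\mathcal F$, first sample $F\sim\mathcal F$. $\mathcal F$ is perfect if $\mathrm{Sets}(\mathcal F)$ is the uniform distribution over $k$-element subsets of $[t]$. $\mathrm{val}(F)=\sum_{I\in F}1/|I|$, $\mathrm{val}(\mathcal F)=\mathbb E_{F\sim\mathcal F}\mathrm{val}(F)$. $F$ is valid if $\sum_{I\in F}|I|\le t/2$; a randomized system is valid if every system in its support is valid. -}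

module Defs where

open import Data.Bool using (Bool; true; false; _∧_; if_then_else_)
open import Data.Nat using (ℕ; zero; suc; _+_; _*_; _∸_; _≤_; _<_; _≡ᵇ_)
open import Data.Fin using (Fin; toℕ)
open import Data.Fin.Subset using (Subset; ∣_∣)
open import Data.Integer using (+_)
open import Data.Rational using (ℚ; _/_; 0ℚ) renaming (_+_ to _+ℚ_; _*_ to _*ℚ_)
open import Data.List using (List; []; _∷_; [_]; map; concatMap; upTo; length; filterᵇ; foldr)
open import Data.Bool.ListAction using (any)
open import Data.List.Relation.Unary.All using (All)
open import Data.List.Relation.Unary.AllPairs using (AllPairs)
open import Data.Vec using (Vec; tabulate)
open import Data.Vec.Properties using (≡-dec)
open import Data.Product using (_×_; _,_; proj₁; proj₂)
open import Data.Sum using (_⊎_)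
open import Relation.Binary.PropositionalEquality using (_≡_)
open import Relation.Nullary using (does)
import Data.Bool.Properties as BoolP
import Data.Rational
import Data.Nat
import Data.Nat.Combinatorics
import Relation.Nullary

-- An interval {a, ..., b} of integers, represented by the pair (a , b).
Interval : Set
Interval = ℕ × ℕ

lo hi : Interval → ℕ
lo = proj₁
hi = proj₂

-- |I| = b - a + 1  (meaningful when a ≤ b)
size : Interval → ℕ
size (a , b) = suc (b ∸ a)

elems : Interval → List ℕ
elems (a , b) = map (λ j → a + j) (upTo (suc (b ∸ a)))

IntervalIn : ℕ → Interval → Set
IntervalIn t (a , b) = (1 ≤ a) × (a ≤ b) × (b ≤ t)

Disjoint : Interval → Interval → Set
Disjoint (a , b) (c , d) = (b < c) ⊎ (d < a)

System : Set
System = List Interval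

IsIntervalSystem : ℕ → ℕ → System → Set
IsIntervalSystem t k F = (length F ≡ k) × All (IntervalIn t) F × AllPairs Disjoint F

totalSize : System → ℕ
totalSize F = foldr (λ I s → size I + s) 0 F

Valid : ℕ → System → Set
Valid t F = 2 * totalSize F ≤ t

-- the fraction n / d as a rational (d is always nonzero where used)
frac : ℕ → ℕ → ℚ
frac n zero    = 0ℚ
frac n (suc d) = (+ n) / suc d

sumℚ : List ℚ → ℚ
sumℚ = foldr _+ℚ_ 0ℚ

val : System → ℚ
val F = sumℚ (map (λ I → frac 1 (size I)) F)

-- all choice tuples (x_I)_{I ∈ F} with x_I ∈ I (equally likely outcomes)
choices : System → List (List ℕ)
choices []       = [ [] ]
choices (I ∷ Is) = concatMap (λ x → map (x ∷_) (choices Is)) (elems I)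

numChoices : System → ℕ
numChoices F = foldr (λ I p → size I * p) 1 F

-- the set {x_I} as a subset of [t]; position i : Fin t stands for element i+1
toSubset : (t : ℕ) → List ℕ → Subset t
toSubset t xs = tabulate (λ i → any (λ x → x ≡ᵇ suc (toℕ i)) xs)

probSets : (t : ℕ) → System → Subset t → ℚ
probSets t F S =
  frac (length (filterᵇ (λ xs → does (≡-dec BoolP._≟_ (toSubset t xs) S)) (choices F)))
       (numChoices F)

-- a randomized interval system: finitely supported distribution, given as
-- a list of (probability , system) pairs
RSystem : Set
RSystem = List (ℚ × System)

IsDistribution : RSystem → Set
IsDistribution 𝓕 = All (λ p → 0ℚ Data.Rational.≤ proj₁ p) 𝓕 × (sumℚ (map proj₁ 𝓕) ≡ Data.Rational.1ℚ)

IsRIntervalSystem : ℕ → ℕ → RSystem → Set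
IsRIntervalSystem t k 𝓕 = IsDistribution 𝓕 × All (λ p → IsIntervalSystem t k (proj₂ p)) 𝓕

RValid : ℕ → RSystem → Set
RValid t 𝓕 = All (λ p → Valid t (proj₂ p)) 𝓕

probSetsR : (t : ℕ) → RSystem → Subset t → ℚ
probSetsR t 𝓕 S = sumℚ (map (λ p → proj₁ p *ℚ probSets t (proj₂ p) S) 𝓕)

uniformK : (t k : ℕ) → Subset t → ℚ
uniformK t k S with ∣ S ∣ Data.Nat.≟ k
... | Relation.Nullary.yes _ = frac 1 (Data.Nat.Combinatorics._C_ t k)
... | Relation.Nullary.no _  = 0ℚ

Perfect : (t k : ℕ) → RSystem → Set
Perfect t k 𝓕 = (S : Subset t) → probSetsR t 𝓕 S ≡ uniformK t k S

valR : RSystem → ℚ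
valR 𝓕 = sumℚ (map (λ p → proj₁ p *ℚ val (proj₂ p)) 𝓕)

-- Choose c with 2k 2^c ≤ t < 4k 2^c and build the distribution recursively on dyadic blocks. A block of
-- 2^d positions that is to receive j intervals gets a single interval covering it if j = 1 and 2^d ≤ 2^c;
-- otherwise it is halved, the left half receives i intervals with the hypergeometric probability
-- C(2^d/2, i) C(2^d/2, j − i) / C(2^d, j), the right half j − i, and both halves recurse. Sets of this
-- distribution is uniform on the j-subsets of the block: for a single interval it picks a uniform
-- singleton, and after a split the choices in the two halves are independent, so the probability of a
-- set S factorises into the probabilities of its two halves and Vandermonde's identity recombines them.
-- All intervals have size at most 2^c, whence validity. For the value, the identities
-- Σ_i i C(N, i) C(N, j − i) = (j / 2) C(2N, j) and Σ_i i (i − 1) C(N, i) C(N, j − i) ≤ (j (j − 1) / 4) C(2N, j)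
-- give by induction on d the bound j / min(2^d, 2^c) + 2 d j (j − 1) / 2^d on the expected value, which
-- for d = m and j = k is at most 4 k² / t + 2 m k² / t.

module Submission where

open import Algebra.Structures using (IsCommutativeSemiring; IsCommutativeRing)
import Data.Nat
import Data.Nat.Properties
import Data.Rational.Properties
open import Relation.Binary.PropositionalEquality using (_≡_)

module Lists where

  open import Data.Nat using (ℕ; zero; suc; _+_; _*_)
  open import Data.List using (List; []; _∷_; _++_; map; concatMap; length)
  open import Data.List.Properties using (length-++; length-map)
  open import Data.List.Relation.Unary.All using (All; []; _∷_)
  import Data.List.Relation.Unary.All as All
  open import Data.List.Relation.Unary.All.Properties using (++⁺; map⁺)
  open import Relation.Binary.PropositionalEquality

  concatUpTo : {X : Set} → (ℕ → List X) → ℕ → List X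
  concatUpTo G zero    = G 0
  concatUpTo G (suc j) = G 0 ++ concatUpTo (λ i → G (suc i)) j

  All-concatUpTo : ∀ {X : Set} {P : X → Set} G j → (∀ i → i Data.Nat.≤ j → All P (G i)) → All P (concatUpTo G j)
  All-concatUpTo G zero    all = all 0 Data.Nat.z≤n
  All-concatUpTo G (suc j) all =
    ++⁺ (all 0 Data.Nat.z≤n) (All-concatUpTo (λ i → G (suc i)) j (λ i i≤j → all (suc i) (Data.Nat.s≤s i≤j)))

  infixr 6 _⊗_
  _⊗_ : {X : Set} → List (List X) → List (List X) → List (List X)
  L₁ ⊗ L₂ = concatMap (λ F₁ → map (F₁ ++_) L₂) L₁

  All-⊗ : ∀ {X : Set} {P₁ P₂ P : List X → Set} {L₁ L₂} → All P₁ L₁ → All P₂ L₂ →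
    (∀ {F₁ F₂} → P₁ F₁ → P₂ F₂ → P (F₁ ++ F₂)) → All P (L₁ ⊗ L₂)
  All-⊗ []         all₂ join = []
  All-⊗ (p₁ ∷ ps₁) all₂ join = ++⁺ (map⁺ (All.map (join p₁) all₂)) (All-⊗ ps₁ all₂ join)

  length-⊗ : ∀ {X : Set} (L₁ L₂ : List (List X)) → length (L₁ ⊗ L₂) ≡ length L₁ * length L₂
  length-⊗ []        L₂ = refl
  length-⊗ (F ∷ L₁) L₂ =
    trans (length-++ (map (F ++_) L₂)) (cong₂ _+_ (length-map (F ++_) L₂) (length-⊗ L₁ L₂))

module Sums {A : Set} {add mul : A → A → A} {0# 1# : A}
            (isCommutativeSemiring : IsCommutativeSemiring _≡_ add mul 0# 1#) where

  private
    infixl 6 _+_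
    _+_ : A → A → A
    _+_ = add

    infixl 7 _*_
    _*_ : A → A → A
    _*_ = mul

  open import Data.Nat as ℕ using (ℕ; zero; suc; _∸_; z≤n; s≤s)
  open import Data.List using (List; []; _∷_; _++_; map; concatMap)
  open import Data.List.Relation.Unary.All using (All; []; _∷_)
  open import Relation.Binary.PropositionalEquality
  open IsCommutativeSemiring isCommutativeSemiring
    using (+-assoc; +-comm; +-identityˡ; +-identityʳ; distribˡ; distribʳ; zeroˡ; zeroʳ)
  open Lists

  private
    +-+-comm : ∀ a b c d → (a + b) + (c + d) ≡ (a + c) + (b + d)
    +-+-comm a b c d = begin
      (a + b) + (c + d) ≡⟨ +-assoc a b (c + d) ⟩
      a + (b + (c + d)) ≡⟨ cong (a +_) (sym (+-assoc b c d)) ⟩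
      a + ((b + c) + d) ≡⟨ cong (λ z → a + (z + d)) (+-comm b c) ⟩
      a + ((c + b) + d) ≡⟨ cong (a +_) (+-assoc c b d) ⟩
      a + (c + (b + d)) ≡⟨ sym (+-assoc a c (b + d)) ⟩
      (a + c) + (b + d) ∎
      where open ≡-Reasoning

  sumBy : {X : Set} → (X → A) → List X → A
  sumBy h []      = 0#
  sumBy h (x ∷ l) = h x + sumBy h l

  sumBy-cong : ∀ {X : Set} {f g : X → A} (l : List X) → (∀ x → f x ≡ g x) → sumBy f l ≡ sumBy g l
  sumBy-cong []      f≡g = refl
  sumBy-cong (x ∷ l) f≡g = cong₂ _+_ (f≡g x) (sumBy-cong l f≡g)

  sumBy-cong-All : ∀ {X : Set} {P : X → Set} {f g : X → A} {l} → All P l →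
    (∀ {x} → P x → f x ≡ g x) → sumBy f l ≡ sumBy g l
  sumBy-cong-All []       f≡g = refl
  sumBy-cong-All (p ∷ ps) f≡g = cong₂ _+_ (f≡g p) (sumBy-cong-All ps f≡g)

  sumBy-++ : ∀ {X : Set} (h : X → A) l₁ l₂ → sumBy h (l₁ ++ l₂) ≡ sumBy h l₁ + sumBy h l₂
  sumBy-++ h []       l₂ = sym (+-identityˡ _)
  sumBy-++ h (x ∷ l₁) l₂ = trans (cong (h x +_) (sumBy-++ h l₁ l₂)) (sym (+-assoc (h x) _ _))

  sumBy-map : ∀ {X Y : Set} (h : Y → A) (g : X → Y) l → sumBy h (map g l) ≡ sumBy (λ x → h (g x)) l
  sumBy-map h g []      = refl
  sumBy-map h g (x ∷ l) = cong (h (g x) +_) (sumBy-map h g l)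

  sumBy-concatMap : ∀ {X Y : Set} (h : Y → A) (f : X → List Y) l →
    sumBy h (concatMap f l) ≡ sumBy (λ x → sumBy h (f x)) l
  sumBy-concatMap h f []      = refl
  sumBy-concatMap h f (x ∷ l) =
    trans (sumBy-++ h (f x) (concatMap f l)) (cong (sumBy h (f x) +_) (sumBy-concatMap h f l))

  sumBy-*ˡ : ∀ {X : Set} c (h : X → A) l → sumBy (λ x → c * h x) l ≡ c * sumBy h l
  sumBy-*ˡ c h []      = sym (zeroʳ c)
  sumBy-*ˡ c h (x ∷ l) = trans (cong (c * h x +_) (sumBy-*ˡ c h l)) (sym (distribˡ c (h x) _))

  sumBy-*ʳ : ∀ {X : Set} c (h : X → A) l → sumBy (λ x → h x * c) l ≡ sumBy h l * c
  sumBy-*ʳ c h []      = sym (zeroˡ c)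
  sumBy-*ʳ c h (x ∷ l) = trans (cong (h x * c +_) (sumBy-*ʳ c h l)) (sym (distribʳ c (h x) _))

  sumBy-+ : ∀ {X : Set} (f g : X → A) l → sumBy (λ x → f x + g x) l ≡ sumBy f l + sumBy g l
  sumBy-+ f g []      = sym (+-identityˡ 0#)
  sumBy-+ f g (x ∷ l) = trans (cong (f x + g x +_) (sumBy-+ f g l)) (+-+-comm (f x) (g x) _ _)

  sumBy-⊗ : ∀ {X : Set} (h : List X → A) L₁ L₂ →
    sumBy h (L₁ ⊗ L₂) ≡ sumBy (λ F₁ → sumBy (λ F₂ → h (F₁ ++ F₂)) L₂) L₁
  sumBy-⊗ h L₁ L₂ = trans (sumBy-concatMap h _ L₁) (sumBy-cong L₁ (λ F₁ → sumBy-map h (F₁ ++_) L₂))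

  sumBy-sumBy-* : ∀ {X Y : Set} {P₁ : X → Set} {P₂ : Y → Set} (h : X → Y → A) (h₁ : X → A) (h₂ : Y → A) {L₁ L₂} →
    All P₁ L₁ → All P₂ L₂ → (∀ {x y} → P₁ x → P₂ y → h x y ≡ h₁ x * h₂ y) →
    sumBy (λ x → sumBy (h x) L₂) L₁ ≡ sumBy h₁ L₁ * sumBy h₂ L₂
  sumBy-sumBy-* h h₁ h₂ {L₁} {L₂} all₁ all₂ h≡h₁*h₂ = begin
    sumBy (λ x → sumBy (h x) L₂) L₁                 ≡⟨ sumBy-cong-All all₁ (λ p₁ → sumBy-cong-All all₂ (h≡h₁*h₂ p₁)) ⟩
    sumBy (λ x → sumBy (λ y → h₁ x * h₂ y) L₂) L₁   ≡⟨ sumBy-cong L₁ (λ x → sumBy-*ˡ (h₁ x) h₂ L₂) ⟩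
    sumBy (λ x → h₁ x * sumBy h₂ L₂) L₁             ≡⟨ sumBy-*ʳ (sumBy h₂ L₂) h₁ L₁ ⟩
    sumBy h₁ L₁ * sumBy h₂ L₂                       ∎
    where open ≡-Reasoning

  sumBy-⊗-* : ∀ {X : Set} {P₁ P₂ : List X → Set} (h h₁ h₂ : List X → A) {L₁ L₂} → All P₁ L₁ → All P₂ L₂ →
    (∀ {F₁ F₂} → P₁ F₁ → P₂ F₂ → h (F₁ ++ F₂) ≡ h₁ F₁ * h₂ F₂) →
    sumBy h (L₁ ⊗ L₂) ≡ sumBy h₁ L₁ * sumBy h₂ L₂
  sumBy-⊗-* h h₁ h₂ {L₁} {L₂} all₁ all₂ h≡h₁*h₂ =
    trans (sumBy-⊗ h L₁ L₂) (sumBy-sumBy-* (λ F₁ F₂ → h (F₁ ++ F₂)) h₁ h₂ all₁ all₂ h≡h₁*h₂)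

  sumUpTo : (ℕ → A) → ℕ → A
  sumUpTo f zero    = f 0
  sumUpTo f (suc j) = f 0 + sumUpTo (λ i → f (suc i)) j

  sumUpTo-cong : ∀ (f g : ℕ → A) j → (∀ i → i ℕ.≤ j → f i ≡ g i) → sumUpTo f j ≡ sumUpTo g j
  sumUpTo-cong f g zero    f≡g = f≡g 0 z≤n
  sumUpTo-cong f g (suc j) f≡g =
    cong₂ _+_ (f≡g 0 z≤n) (sumUpTo-cong _ _ j (λ i i≤j → f≡g (suc i) (s≤s i≤j)))

  sumUpTo-+ : ∀ (f g : ℕ → A) j → sumUpTo (λ i → f i + g i) j ≡ sumUpTo f j + sumUpTo g j
  sumUpTo-+ f g zero    = refl
  sumUpTo-+ f g (suc j) = trans (cong (f 0 + g 0 +_) (sumUpTo-+ _ _ j)) (+-+-comm (f 0) (g 0) _ _)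

  sumUpTo-*ˡ : ∀ c (f : ℕ → A) j → sumUpTo (λ i → c * f i) j ≡ c * sumUpTo f j
  sumUpTo-*ˡ c f zero    = refl
  sumUpTo-*ˡ c f (suc j) = trans (cong (c * f 0 +_) (sumUpTo-*ˡ c _ j)) (sym (distribˡ c (f 0) _))

  sumUpTo-zero : ∀ j → sumUpTo (λ _ → 0#) j ≡ 0#
  sumUpTo-zero zero    = refl
  sumUpTo-zero (suc j) = trans (cong (0# +_) (sumUpTo-zero j)) (+-identityˡ 0#)

  sumUpTo-suc : ∀ (f : ℕ → A) j → sumUpTo f (suc j) ≡ sumUpTo f j + f (suc j)
  sumUpTo-suc f zero    = refl
  sumUpTo-suc f (suc j) = trans (cong (f 0 +_) (sumUpTo-suc _ j)) (sym (+-assoc (f 0) _ _))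

  sumUpTo-reverse : ∀ (f : ℕ → A) j → sumUpTo (λ i → f (j ∸ i)) j ≡ sumUpTo f j
  sumUpTo-reverse f zero    = refl
  sumUpTo-reverse f (suc j) = begin
    f (suc j) + sumUpTo (λ i → f (j ∸ i)) j ≡⟨ cong (f (suc j) +_) (sumUpTo-reverse f j) ⟩
    f (suc j) + sumUpTo f j                 ≡⟨ +-comm (f (suc j)) _ ⟩
    sumUpTo f j + f (suc j)                 ≡⟨ sumUpTo-suc f j ⟨
    sumUpTo f (suc j)                       ∎
    where open ≡-Reasoning

  sumBy-concatUpTo : ∀ {X : Set} (h : X → A) G j → sumBy h (concatUpTo G j) ≡ sumUpTo (λ i → sumBy h (G i)) j
  sumBy-concatUpTo h G zero    = refl
  sumBy-concatUpTo h G (suc j) =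
    trans (sumBy-++ h (G 0) _) (cong (sumBy h (G 0) +_) (sumBy-concatUpTo h (λ i → G (suc i)) j))

module ℕSum = Sums Data.Nat.Properties.+-*-isCommutativeSemiring
module ℚSum = Sums (IsCommutativeRing.isCommutativeSemiring Data.Rational.Properties.+-*-isCommutativeRing)

module Fraction where

  open import Data.Nat as ℕ using (ℕ; zero; suc)
  import Data.Nat.Properties as ℕ
  open import Data.Integer as ℤ using (+_)
  import Data.Integer.Properties as ℤ
  open import Data.Rational as ℚ using (ℚ; 0ℚ; 1ℚ; toℚᵘ)
  import Data.Rational.Properties as ℚ
  open import Data.Rational.Unnormalised as ℚᵘ using (mkℚᵘ; *≡*; *≤*)
  import Data.Rational.Unnormalised.Properties as ℚᵘ
  open import Data.List using ([]; _∷_; map; replicate)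
  open import Relation.Binary.PropositionalEquality
  open import Defs using (frac; sumℚ)

  private
    toℚᵘ-frac : ∀ a d → toℚᵘ (frac a (suc d)) ℚᵘ.≃ mkℚᵘ (+ a) d
    toℚᵘ-frac a d = ℚ.toℚᵘ-fromℚᵘ (mkℚᵘ (+ a) d)

    pos-*-cross : ∀ a b c d → a ℕ.* b ≡ c ℕ.* d → + a ℤ.* + b ≡ + c ℤ.* + d
    pos-*-cross a b c d eq = trans (sym (ℤ.pos-* a b)) (trans (cong +_ eq) (ℤ.pos-* c d))

  frac-cross : ∀ a b n m → 1 ℕ.≤ n → 1 ℕ.≤ m → a ℕ.* m ≡ b ℕ.* n → frac a n ≡ frac b m
  frac-cross a b (suc n) (suc m) _ _ eq = ℚ.toℚᵘ-injective
    (ℚᵘ.≃-trans (toℚᵘ-frac a n) (ℚᵘ.≃-trans (*≡* (pos-*-cross a (suc m) b (suc n) eq)) (ℚᵘ.≃-sym (toℚᵘ-frac b m))))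

  frac-+ : ∀ a b n → frac a n ℚ.+ frac b n ≡ frac (a ℕ.+ b) n
  frac-+ a b zero = refl
  frac-+ a b (suc d) = ℚ.toℚᵘ-injective
    (ℚᵘ.≃-trans (ℚ.toℚᵘ-homo-+ (frac a (suc d)) (frac b (suc d)))
    (ℚᵘ.≃-trans (ℚᵘ.+-cong (toℚᵘ-frac a d) (toℚᵘ-frac b d))
    (ℚᵘ.≃-trans (*≡* cross) (ℚᵘ.≃-sym (toℚᵘ-frac (a ℕ.+ b) d)))))
    where
    s : ℕ
    s = suc d
    cross : (+ a ℤ.* + s ℤ.+ + b ℤ.* + s) ℤ.* + s ≡ + (a ℕ.+ b) ℤ.* + (s ℕ.* s)
    cross = begin
      (+ a ℤ.* + s ℤ.+ + b ℤ.* + s) ℤ.* + s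
        ≡⟨ cong₂ (λ x y → (x ℤ.+ y) ℤ.* + s) (sym (ℤ.pos-* a s)) (sym (ℤ.pos-* b s)) ⟩
      + (a ℕ.* s ℕ.+ b ℕ.* s) ℤ.* + s
        ≡⟨ pos-*-cross (a ℕ.* s ℕ.+ b ℕ.* s) s (a ℕ.+ b) (s ℕ.* s)
             (trans (cong (ℕ._* s) (sym (ℕ.*-distribʳ-+ s a b))) (ℕ.*-assoc (a ℕ.+ b) s s)) ⟩
      + (a ℕ.+ b) ℤ.* + (s ℕ.* s) ∎
      where open ≡-Reasoning

  frac-* : ∀ a b n m → frac a n ℚ.* frac b m ≡ frac (a ℕ.* b) (n ℕ.* m)
  frac-* a b zero m = ℚ.*-zeroˡ (frac b m)
  frac-* a b (suc n) zero rewrite ℕ.*-zeroʳ n = ℚ.*-zeroʳ (frac a (suc n))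
  frac-* a b (suc n) (suc m) = ℚ.toℚᵘ-injective
    (ℚᵘ.≃-trans (ℚ.toℚᵘ-homo-* (frac a (suc n)) (frac b (suc m)))
    (ℚᵘ.≃-trans (ℚᵘ.*-cong (toℚᵘ-frac a n) (toℚᵘ-frac b m))
    (ℚᵘ.≃-trans (*≡* (cong (ℤ._* + (suc n ℕ.* suc m)) (sym (ℤ.pos-* a b))))
                (ℚᵘ.≃-sym (toℚᵘ-frac (a ℕ.* b) _)))))

  frac-mono : ∀ a b n m → 1 ℕ.≤ n → 1 ℕ.≤ m → a ℕ.* m ℕ.≤ b ℕ.* n → frac a n ℚ.≤ frac b m
  frac-mono a b (suc n) (suc m) _ _ le = ℚ.toℚᵘ-cancel-≤
    (ℚᵘ.≤-respˡ-≃ (ℚᵘ.≃-sym (toℚᵘ-frac a n)) (ℚᵘ.≤-respʳ-≃ (ℚᵘ.≃-sym (toℚᵘ-frac b m))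
      (*≤* (subst₂ ℤ._≤_ (ℤ.pos-* a (suc m)) (ℤ.pos-* b (suc n)) (ℤ.+≤+ le)))))

  frac-zero : ∀ n → frac 0 n ≡ 0ℚ
  frac-zero zero = refl
  frac-zero (suc n) = frac-cross 0 0 (suc n) 1 (ℕ.s≤s ℕ.z≤n) ℕ.≤-refl refl

  frac-nonneg : ∀ a n → 0ℚ ℚ.≤ frac a n
  frac-nonneg a zero = ℚ.≤-refl
  frac-nonneg a (suc n) = subst (ℚ._≤ frac a (suc n)) (frac-zero 1) (frac-mono 0 a 1 (suc n) ℕ.≤-refl (ℕ.s≤s ℕ.z≤n) ℕ.z≤n)

  frac-self : ∀ n → 1 ℕ.≤ n → frac n n ≡ 1ℚ
  frac-self n 1≤n = frac-cross n 1 n 1 1≤n ℕ.≤-refl (ℕ.*-comm n 1)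

  sumℚ-map : ∀ {X : Set} (h : X → ℚ) l → sumℚ (map h l) ≡ ℚSum.sumBy h l
  sumℚ-map h []      = refl
  sumℚ-map h (x ∷ l) = cong (h x ℚ.+_) (sumℚ-map h l)

  frac-sumBy : ∀ {X : Set} (f : X → ℕ) n l → ℚSum.sumBy (λ x → frac (f x) n) l ≡ frac (ℕSum.sumBy f l) n
  frac-sumBy f n []      = sym (frac-zero n)
  frac-sumBy f n (x ∷ l) = trans (cong (frac (f x) n ℚ.+_) (frac-sumBy f n l)) (frac-+ (f x) _ n)

  frac-sumUpTo : ∀ (f : ℕ → ℕ) n j → ℚSum.sumUpTo (λ i → frac (f i) n) j ≡ frac (ℕSum.sumUpTo f j) n
  frac-sumUpTo f n zero    = refl
  frac-sumUpTo f n (suc j) =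
    trans (cong (frac (f 0) n ℚ.+_) (frac-sumUpTo (λ i → f (suc i)) n j)) (frac-+ (f 0) _ n)

  frac-cancelˡ : ∀ k a n → 1 ℕ.≤ k → 1 ℕ.≤ n → frac (k ℕ.* a) (k ℕ.* n) ≡ frac a n
  frac-cancelˡ k a n 1≤k 1≤n = frac-cross (k ℕ.* a) a (k ℕ.* n) n (ℕ.*-mono-≤ 1≤k 1≤n) 1≤n (begin
    k ℕ.* a ℕ.* n     ≡⟨ ℕ.*-assoc k a n ⟩
    k ℕ.* (a ℕ.* n)   ≡⟨ cong (k ℕ.*_) (ℕ.*-comm a n) ⟩
    k ℕ.* (n ℕ.* a)   ≡⟨ ℕ.*-assoc k n a ⟨
    k ℕ.* n ℕ.* a     ≡⟨ ℕ.*-comm (k ℕ.* n) a ⟩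
    a ℕ.* (k ℕ.* n)   ∎)
    where open ≡-Reasoning

  frac-reciprocal : ∀ v s N → 1 ℕ.≤ s → 1 ℕ.≤ N → v ℕ.* s ≡ N → frac 1 s ≡ frac v N
  frac-reciprocal v s N 1≤s 1≤N v*s≡N = frac-cross 1 v s N 1≤s 1≤N (trans (ℕ.+-identityʳ N) (sym v*s≡N))

  frac-sumBy-replicate : ∀ {X : Set} (h : X → ℚ) n x a d → h x ≡ frac a d →
    ℚSum.sumBy h (replicate n x) ≡ frac (n ℕ.* a) d
  frac-sumBy-replicate h zero    x a d hx = sym (frac-zero d)
  frac-sumBy-replicate h (suc n) x a d hx =
    trans (cong₂ ℚ._+_ hx (frac-sumBy-replicate h n x a d hx)) (frac-+ a (n ℕ.* a) d)

module Binomial where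

  open import Data.Nat
  open import Data.Nat.Properties
  open import Data.Nat.Tactic.RingSolver
  open import Data.Nat.Combinatorics using (_C_; nCk+nC[k+1]≡[n+1]C[k+1])
  open import Relation.Nullary using (contradiction)
  open import Relation.Binary.PropositionalEquality
  open ℕSum using (sumUpTo; sumUpTo-cong; sumUpTo-+; sumUpTo-*ˡ; sumUpTo-zero; sumUpTo-reverse)

  choose : ℕ → ℕ → ℕ
  choose n       zero    = 1
  choose zero    (suc k) = 0
  choose (suc n) (suc k) = choose n k + choose n (suc k)

  choose≡C : ∀ n k → choose n k ≡ n C k
  choose≡C n       zero    = refl
  choose≡C zero    (suc k) = refl
  choose≡C (suc n) (suc k) =
    trans (cong₂ _+_ (choose≡C n k) (choose≡C n (suc k))) (nCk+nC[k+1]≡[n+1]C[k+1] n k)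

  choose-1 : ∀ n → choose n 1 ≡ n
  choose-1 zero    = refl
  choose-1 (suc n) = cong suc (choose-1 n)

  choose-pos : ∀ n k → k ≤ n → 1 ≤ choose n k
  choose-pos n       zero    _         = s≤s z≤n
  choose-pos (suc n) (suc k) (s≤s k≤n) = ≤-trans (choose-pos n k k≤n) (m≤m+n (choose n k) _)

  choose-absorb : ∀ n j → suc j * choose (suc n) (suc j) ≡ suc n * choose n j
  choose-absorb zero    zero    = refl
  choose-absorb zero    (suc j) = *-zeroʳ (suc (suc j))
  choose-absorb (suc n) zero    rewrite choose-1 n | *-identityʳ n | +-identityʳ n = refl
  choose-absorb (suc n) (suc j) = begin
    suc (suc j) * (choose (suc n) (suc j) + choose (suc n) (suc (suc j)))
      ≡⟨ regroup (suc j) (choose (suc n) (suc j)) _ ⟩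
    suc j * choose (suc n) (suc j) + choose (suc n) (suc j) + suc (suc j) * choose (suc n) (suc (suc j))
      ≡⟨ cong₂ (λ x y → x + choose (suc n) (suc j) + y) (choose-absorb n j) (choose-absorb n (suc j)) ⟩
    suc n * choose n j + choose (suc n) (suc j) + suc n * choose n (suc j)
      ≡⟨ collect (suc n) (choose n j) _ _ ⟩
    choose (suc n) (suc j) + suc n * (choose n j + choose n (suc j)) ∎
    where
    open ≡-Reasoning
    regroup : ∀ j x y → (1 + j) * (x + y) ≡ j * x + x + (1 + j) * y
    regroup = solve-∀
    collect : ∀ n a c b → n * a + c + n * b ≡ c + n * (a + b)
    collect = solve-∀

  choose-absorb₂ : ∀ n j → suc (suc j) * suc j * choose (suc (suc n)) (suc (suc j)) ≡ suc (suc n) * suc n * choose n j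
  choose-absorb₂ n j = begin
    suc (suc j) * suc j * choose (suc (suc n)) (suc (suc j))
      ≡⟨ swap (suc (suc j)) (suc j) _ ⟩
    suc j * (suc (suc j) * choose (suc (suc n)) (suc (suc j)))
      ≡⟨ cong (suc j *_) (choose-absorb (suc n) (suc j)) ⟩
    suc j * (suc (suc n) * choose (suc n) (suc j))
      ≡⟨ *-comm (suc j) _ ⟩
    suc (suc n) * choose (suc n) (suc j) * suc j
      ≡⟨ *-assoc (suc (suc n)) (choose (suc n) (suc j)) (suc j) ⟩
    suc (suc n) * (choose (suc n) (suc j) * suc j)
      ≡⟨ cong (suc (suc n) *_) (trans (*-comm _ (suc j)) (choose-absorb n j)) ⟩
    suc (suc n) * (suc n * choose n j)
      ≡⟨ *-assoc (suc (suc n)) (suc n) _ ⟨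
    suc (suc n) * suc n * choose n j ∎
    where
    open ≡-Reasoning
    swap : ∀ a b x → a * b * x ≡ b * (a * x)
    swap = solve-∀

  sumUpTo-mono-≤ : ∀ (f g : ℕ → ℕ) j → (∀ i → i ≤ j → f i ≤ g i) → sumUpTo f j ≤ sumUpTo g j
  sumUpTo-mono-≤ f g zero    f≤g = f≤g 0 z≤n
  sumUpTo-mono-≤ f g (suc j) f≤g =
    +-mono-≤ (f≤g 0 z≤n) (sumUpTo-mono-≤ _ _ j (λ i i≤j → f≤g (suc i) (s≤s i≤j)))

  infixl 7 _⋆_
  _⋆_ : (ℕ → ℕ) → (ℕ → ℕ) → ℕ → ℕ
  (f ⋆ g) j = sumUpTo (λ i → f i * g (j ∸ i)) j

  ⋆-comm : ∀ f g j → (f ⋆ g) j ≡ (g ⋆ f) j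
  ⋆-comm f g j = trans (sym (sumUpTo-reverse _ j)) (sumUpTo-cong _ _ j λ i i≤j →
    trans (cong (λ z → f (j ∸ i) * g z) (m∸[m∸n]≡n i≤j)) (*-comm (f (j ∸ i)) (g i)))

  ⋆-distribʳ-+ : ∀ f h g j → ((λ i → f i + h i) ⋆ g) j ≡ (f ⋆ g) j + (h ⋆ g) j
  ⋆-distribʳ-+ f h g j =
    trans (sumUpTo-cong _ _ j (λ i _ → *-distribʳ-+ (g (j ∸ i)) (f i) (h i))) (sumUpTo-+ _ _ j)

  choose-vandermonde : ∀ a b j → (choose a ⋆ choose b) j ≡ choose (a + b) j
  choose-vandermonde zero    b zero    = +-identityʳ (choose b 0)
  choose-vandermonde zero    b (suc j) =
    trans (cong₂ _+_ (+-identityʳ (choose b (suc j))) (sumUpTo-zero j)) (+-identityʳ _)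
  choose-vandermonde (suc a) b zero    = refl
  choose-vandermonde (suc a) b (suc j) = begin
    choose b (suc j) + 0 + sumUpTo (λ i → (choose a i + choose a (suc i)) * choose b (j ∸ i)) j
      ≡⟨ cong (choose b (suc j) + 0 +_) (⋆-distribʳ-+ (choose a) (λ i → choose a (suc i)) (choose b) j) ⟩
    choose b (suc j) + 0 + ((choose a ⋆ choose b) j + sumUpTo (λ i → choose a (suc i) * choose b (j ∸ i)) j)
      ≡⟨ +-left-comm (choose b (suc j) + 0) ((choose a ⋆ choose b) j) _ ⟩
    (choose a ⋆ choose b) j + (choose a ⋆ choose b) (suc j)
      ≡⟨ cong₂ _+_ (choose-vandermonde a b j) (choose-vandermonde a b (suc j)) ⟩
    choose (a + b) j + choose (a + b) (suc j) ∎
    where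
    open ≡-Reasoning
    +-left-comm : ∀ x y z → x + (y + z) ≡ y + (x + z)
    +-left-comm = solve-∀

  choose-⋆-mean : ∀ N j → sumUpTo (λ i → (i + (j ∸ i)) * (choose N i * choose N (j ∸ i))) j ≡ j * choose (N + N) j
  choose-⋆-mean N j = begin
    sumUpTo (λ i → (i + (j ∸ i)) * (choose N i * choose N (j ∸ i))) j
      ≡⟨ sumUpTo-cong _ _ j (λ i i≤j → cong (_* (choose N i * choose N (j ∸ i))) (m+[n∸m]≡n i≤j)) ⟩
    sumUpTo (λ i → j * (choose N i * choose N (j ∸ i))) j
      ≡⟨ sumUpTo-*ˡ j _ j ⟩
    j * (choose N ⋆ choose N) j
      ≡⟨ cong (j *_) (choose-vandermonde N N j) ⟩
    j * choose (N + N) j ∎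
    where open ≡-Reasoning

  shift₂ : (ℕ → ℕ) → ℕ → ℕ
  shift₂ f zero          = 0
  shift₂ f (suc zero)    = 0
  shift₂ f (suc (suc i)) = f i

  ⋆-shift₂ : ∀ f g j → (shift₂ f ⋆ g) j ≡ shift₂ (f ⋆ g) j
  ⋆-shift₂ f g zero          = refl
  ⋆-shift₂ f g (suc zero)    = refl
  ⋆-shift₂ f g (suc (suc j)) = refl

  -- j (j - 1) C(n, j), written as n (n - 1) C(n - 2, j - 2) so that it convolves by Vandermonde's identity
  fallingChoose : ℕ → ℕ → ℕ
  fallingChoose n j = n * (n ∸ 1) * shift₂ (choose (n ∸ 2)) j

  fallingChoose≡ : ∀ n j → fallingChoose n j ≡ j * (j ∸ 1) * choose n j
  fallingChoose≡ n             zero          = *-zeroʳ (n * (n ∸ 1))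
  fallingChoose≡ n             (suc zero)    = *-zeroʳ (n * (n ∸ 1))
  fallingChoose≡ zero          (suc (suc j)) = sym (*-zeroʳ (suc (suc j) * suc j))
  fallingChoose≡ (suc zero)    (suc (suc j)) = sym (*-zeroʳ (suc (suc j) * suc j))
  fallingChoose≡ (suc (suc n)) (suc (suc j)) = sym (choose-absorb₂ n j)

  fallingChoose-⋆ : ∀ N j → (fallingChoose N ⋆ choose N) j ≡ N * (N ∸ 1) * shift₂ (choose (N ∸ 2 + N)) j
  fallingChoose-⋆ N j = begin
    (fallingChoose N ⋆ choose N) j
      ≡⟨ sumUpTo-cong _ _ j (λ i _ → *-assoc (N * (N ∸ 1)) (shift₂ (choose (N ∸ 2)) i) _) ⟩
    sumUpTo (λ i → N * (N ∸ 1) * (shift₂ (choose (N ∸ 2)) i * choose N (j ∸ i))) j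
      ≡⟨ sumUpTo-*ˡ (N * (N ∸ 1)) _ j ⟩
    N * (N ∸ 1) * (shift₂ (choose (N ∸ 2)) ⋆ choose N) j
      ≡⟨ cong (N * (N ∸ 1) *_) (trans (⋆-shift₂ (choose (N ∸ 2)) (choose N) j) (shift₂-vandermonde j)) ⟩
    N * (N ∸ 1) * shift₂ (choose (N ∸ 2 + N)) j ∎
    where
    open ≡-Reasoning
    shift₂-vandermonde : ∀ j → shift₂ (choose (N ∸ 2) ⋆ choose N) j ≡ shift₂ (choose (N ∸ 2 + N)) j
    shift₂-vandermonde zero          = refl
    shift₂-vandermonde (suc zero)    = refl
    shift₂-vandermonde (suc (suc j)) = choose-vandermonde (N ∸ 2) N j

  fallingChoose-⋆-≤ : ∀ N j → 4 * (fallingChoose N ⋆ choose N) j ≤ fallingChoose (N + N) j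
  fallingChoose-⋆-≤ zero          j = ≤-reflexive (cong (4 *_) (fallingChoose-⋆ 0 j))
  fallingChoose-⋆-≤ (suc zero)    j = subst (_≤ fallingChoose 2 j) (cong (4 *_) (sym (fallingChoose-⋆ 1 j))) z≤n
  fallingChoose-⋆-≤ (suc (suc n)) j = begin
    4 * (fallingChoose N ⋆ choose N) j       ≡⟨ cong (4 *_) (fallingChoose-⋆ N j) ⟩
    4 * (N * suc n * Z)                      ≡⟨ *-assoc 4 (N * suc n) Z ⟨
    4 * (N * suc n) * Z                      ≤⟨ *-monoˡ-≤ Z (subst (4 * (N * suc n) ≤_) (sym (expand n)) (m≤m+n _ _)) ⟩
    (N + N) * (n + N + 1) * Z                ≡⟨ cong (λ z → (N + N) * z * Z) (+-comm (n + N) 1) ⟩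
    fallingChoose (N + N) j                  ∎
    where
    open ≤-Reasoning
    N : ℕ
    N = suc (suc n)
    Z : ℕ
    Z = shift₂ (choose (n + N)) j
    expand : ∀ n → (suc (suc n) + suc (suc n)) * (n + suc (suc n) + 1) ≡ 4 * (suc (suc n) * suc n) + 2 * suc (suc n)
    expand = solve-∀

  choose-≤-fallingChoose : ∀ n j → j ≢ 1 → j * choose n j ≤ 2 * fallingChoose n j
  choose-≤-fallingChoose n zero          _   = z≤n
  choose-≤-fallingChoose n (suc zero)    j≢1 = contradiction refl j≢1
  choose-≤-fallingChoose n (suc (suc j)) _   rewrite fallingChoose≡ n (suc (suc j)) =
    ≤-trans (*-monoˡ-≤ (choose n (suc (suc j))) (m≤m*n (suc (suc j)) (suc j)))
            (m≤m+n (suc (suc j) * suc j * choose n (suc (suc j))) _)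


module Counting where

  open import Data.Bool using (Bool; true; false; _∧_)
  open import Data.Nat
  open import Data.Nat.Properties using (+-identityʳ)
  open import Data.List using (List; []; _∷_; length; filterᵇ)
  open import Data.List.Properties using (length-++)
  open import Relation.Binary.PropositionalEquality
  open Binomial using (_⋆_)
  open Lists using (concatUpTo)
  open ℕSum using (sumBy; sumUpTo; sumUpTo-zero)

  𝟙 : Bool → ℕ
  𝟙 true  = 1
  𝟙 false = 0

  𝟙-∧ : ∀ a b → 𝟙 (a ∧ b) ≡ 𝟙 a * 𝟙 b
  𝟙-∧ true  b = sym (+-identityʳ (𝟙 b))
  𝟙-∧ false b = refl

  length-filterᵇ : ∀ {X : Set} (p : X → Bool) l → length (filterᵇ p l) ≡ sumBy (λ x → 𝟙 (p x)) l
  length-filterᵇ p []      = refl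
  length-filterᵇ p (x ∷ l) with p x
  ... | true  = cong suc (length-filterᵇ p l)
  ... | false = length-filterᵇ p l

  sumBy-const : ∀ {X : Set} a (l : List X) → sumBy (λ _ → a) l ≡ length l * a
  sumBy-const a []      = refl
  sumBy-const a (x ∷ l) = cong (a +_) (sumBy-const a l)

  length-concatUpTo : ∀ {X : Set} (G : ℕ → List X) j → length (concatUpTo G j) ≡ sumUpTo (λ i → length (G i)) j
  length-concatUpTo G zero    = refl
  length-concatUpTo G (suc j) = trans (length-++ (G 0)) (cong (length (G 0) +_) (length-concatUpTo (λ i → G (suc i)) j))

  𝟙≡ᵇ-⋆ : ∀ x y j → ((λ i → 𝟙 (x ≡ᵇ i)) ⋆ (λ i → 𝟙 (y ≡ᵇ i))) j ≡ 𝟙 (x + y ≡ᵇ j)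
  𝟙≡ᵇ-⋆ zero    zero    zero    = refl
  𝟙≡ᵇ-⋆ zero    (suc y) zero    = refl
  𝟙≡ᵇ-⋆ (suc x) y       zero    = refl
  𝟙≡ᵇ-⋆ zero    y       (suc j) =
    trans (cong₂ _+_ (+-identityʳ (𝟙 (y ≡ᵇ suc j))) (sumUpTo-zero j)) (+-identityʳ _)
  𝟙≡ᵇ-⋆ (suc x) y       (suc j) = 𝟙≡ᵇ-⋆ x y j

module SubsetProperties where

  open import Data.Bool using (Bool; true; false; _∧_; _∨_; not)
  open import Data.Bool.Properties using (∧-zeroʳ; ∧-identityʳ; ∨-zeroʳ)
  open import Data.Nat using (ℕ; zero; suc; _+_; _*_; _∸_; _≡ᵇ_; _≤_; _<_)
  open import Data.Nat.Properties using (+-suc; +-identityʳ; _≟_; <⇒≢; ≤-<-trans; n≤0⇒n≡0; suc-injective)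
  open import Data.Fin using (Fin; zero; suc)
  import Data.Fin.Properties as Fin
  open import Data.Fin.Subset
  open import Data.Fin.Subset.Properties
    using (∪-comm; ∩-comm; ∩-zeroʳ; ∣⊥∣≡0; p─⊥≡p; p─⊤≡⊥; p─q─r≡p─q∪r; ∣p∩q∣≤∣q∣; ∣p─q∣≤∣p∣; ∣⁅x⁆∣≡1)
  open import Data.Product using (_×_; _,_)
  open import Data.Vec using ([]; _∷_; lookup)
  open import Data.Vec.Properties
    using (tabulate∘lookup; tabulate-cong; lookup-zipWith; lookup-replicate; ∷-injectiveˡ; ∷-injectiveʳ; []=⇒lookup; lookup⇒[]=)
  open import Function.Base using (case_of_)
  open import Function.Bundles using (_⇔_; mk⇔)
  open import Relation.Nullary using (Dec; does; _×-dec_)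
  open import Relation.Nullary.Decidable using (does-⇔; dec-false)
  open import Relation.Binary.PropositionalEquality
  open Counting using (𝟙; 𝟙≡ᵇ-⋆)
  open Binomial using (_⋆_)
  open ℕSum using (sumUpTo; sumUpTo-cong; sumUpTo-zero)

  ∣∣-∷ : ∀ {n} b (p : Subset n) → ∣ b ∷ p ∣ ≡ 𝟙 b + ∣ p ∣
  ∣∣-∷ true  p = refl
  ∣∣-∷ false p = refl

  ≡-by-lookup : ∀ {n} {p q : Subset n} → (∀ i → lookup p i ≡ lookup q i) → p ≡ q
  ≡-by-lookup {p = p} {q} p≗q = trans (sym (tabulate∘lookup p)) (trans (tabulate-cong p≗q) (tabulate∘lookup q))

  ⊆-lookup : ∀ {n} {p q : Subset n} → p ⊆ q → ∀ i → lookup p i ≡ true → lookup q i ≡ true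
  ⊆-lookup {p = p} {q} p⊆q i p[i] = []=⇒lookup (p⊆q (lookup⇒[]= i p p[i]))

  lookup-∪ : ∀ {n} (p q : Subset n) i → lookup (p ∪ q) i ≡ lookup p i ∨ lookup q i
  lookup-∪ p q i = lookup-zipWith _∨_ i p q

  lookup-∩ : ∀ {n} (p q : Subset n) i → lookup (p ∩ q) i ≡ lookup p i ∧ lookup q i
  lookup-∩ p q i = lookup-zipWith _∧_ i p q

  lookup-─ : ∀ {n} (p q : Subset n) i → lookup (p ─ q) i ≡ lookup p i ∧ not (lookup q i)
  lookup-─ (x ∷ p) (true  ∷ q) zero    = sym (∧-zeroʳ x)
  lookup-─ (x ∷ p) (false ∷ q) zero    = sym (∧-identityʳ x)
  lookup-─ (x ∷ p) (y     ∷ q) (suc i) = lookup-─ p q i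

  lookup-⊥ : ∀ {n} (i : Fin n) → lookup ⊥ i ≡ false
  lookup-⊥ i = lookup-replicate i false

  lookup-⊤ : ∀ {n} (i : Fin n) → lookup ⊤ i ≡ true
  lookup-⊤ i = lookup-replicate i true

  lookup-⁅⁆ : ∀ {n} (i j : Fin n) → lookup ⁅ i ⁆ j ≡ does (j Fin.≟ i)
  lookup-⁅⁆ zero    zero    = refl
  lookup-⁅⁆ zero    (suc j) = lookup-⊥ j
  lookup-⁅⁆ (suc i) zero    = refl
  lookup-⁅⁆ (suc i) (suc j) = lookup-⁅⁆ i j

  lookup⇒⊆ : ∀ {n} {p q : Subset n} → (∀ i → lookup p i ≡ true → lookup q i ≡ true) → p ⊆ q
  lookup⇒⊆ {p = p} {q} p⇒q {i} i∈p = lookup⇒[]= i q (p⇒q i ([]=⇒lookup i∈p))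

  ∩≡⊥-lookup : ∀ {n} {p q : Subset n} → p ∩ q ≡ ⊥ → ∀ i → lookup p i ∧ lookup q i ≡ false
  ∩≡⊥-lookup {p = p} {q} p∩q≡⊥ i = trans (sym (lookup-∩ p q i)) (trans (cong (λ r → lookup r i) p∩q≡⊥) (lookup-⊥ i))

  private
    ∨-∧-not-cancel : ∀ x y a b → (x ≡ true → a ≡ true) → (y ≡ true → b ≡ true) → a ∧ b ≡ false →
      (x ∨ y) ∧ not b ≡ x
    ∨-∧-not-cancel true  y     true  false x⇒a y⇒b a∧b = refl
    ∨-∧-not-cancel true  y     false b     x⇒a y⇒b a∧b with () ← x⇒a refl
    ∨-∧-not-cancel false true  a     true  x⇒a y⇒b a∧b = refl
    ∨-∧-not-cancel false true  a     false x⇒a y⇒b a∧b with () ← y⇒b refl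
    ∨-∧-not-cancel false false a     b     x⇒a y⇒b a∧b = refl

    ∧-not-cover : ∀ s a b → a ∧ b ≡ false → (s ∧ not b) ∨ (s ∧ not a) ≡ s
    ∧-not-cover false a     b     a∧b = refl
    ∧-not-cover true  false b     a∧b = ∨-zeroʳ (not b)
    ∧-not-cover true  true  false a∧b = refl

  ∪─-cancel : ∀ {n} {X Y A B : Subset n} → X ⊆ A → Y ⊆ B → A ∩ B ≡ ⊥ → (X ∪ Y) ─ B ≡ X
  ∪─-cancel {X = X} {Y} {A} {B} X⊆A Y⊆B A∩B≡⊥ = ≡-by-lookup λ i → begin
    lookup ((X ∪ Y) ─ B) i                         ≡⟨ lookup-─ (X ∪ Y) B i ⟩
    lookup (X ∪ Y) i ∧ not (lookup B i)            ≡⟨ cong (λ z → z ∧ not (lookup B i)) (lookup-∪ X Y i) ⟩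
    (lookup X i ∨ lookup Y i) ∧ not (lookup B i)
      ≡⟨ ∨-∧-not-cancel _ _ _ _ (⊆-lookup X⊆A i) (⊆-lookup Y⊆B i) (∩≡⊥-lookup A∩B≡⊥ i) ⟩
    lookup X i                                     ∎
    where open ≡-Reasoning

  ─∪─-cover : ∀ {n} {A B : Subset n} (S : Subset n) → A ∩ B ≡ ⊥ → (S ─ B) ∪ (S ─ A) ≡ S
  ─∪─-cover {A = A} {B} S A∩B≡⊥ = ≡-by-lookup λ i → begin
    lookup ((S ─ B) ∪ (S ─ A)) i                 ≡⟨ lookup-∪ (S ─ B) (S ─ A) i ⟩
    lookup (S ─ B) i ∨ lookup (S ─ A) i          ≡⟨ cong₂ _∨_ (lookup-─ S B i) (lookup-─ S A i) ⟩
    (lookup S i ∧ not (lookup B i)) ∨ (lookup S i ∧ not (lookup A i))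
                                                 ≡⟨ ∧-not-cover _ _ _ (∩≡⊥-lookup A∩B≡⊥ i) ⟩
    lookup S i                                   ∎
    where open ≡-Reasoning

  ∪≡⇔─ : ∀ {n} {X Y A B : Subset n} (S : Subset n) → X ⊆ A → Y ⊆ B → A ∩ B ≡ ⊥ →
    (X ∪ Y ≡ S) ⇔ (X ≡ S ─ B × Y ≡ S ─ A)
  ∪≡⇔─ {X = X} {Y} {A} {B} S X⊆A Y⊆B A∩B≡⊥ = mk⇔
    (λ { refl → sym (∪─-cancel X⊆A Y⊆B A∩B≡⊥)
              , sym (trans (cong (_─ A) (∪-comm X Y)) (∪─-cancel Y⊆B X⊆A (trans (∩-comm B A) A∩B≡⊥))) })
    (λ { (refl , refl) → ─∪─-cover S A∩B≡⊥ })

  ∣∪∣-disjoint : ∀ {n} (X Y : Subset n) → X ∩ Y ≡ ⊥ → ∣ X ∪ Y ∣ ≡ ∣ X ∣ + ∣ Y ∣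
  ∣∪∣-disjoint []          []          _  = refl
  ∣∪∣-disjoint (true  ∷ X) (true  ∷ Y) ()
  ∣∪∣-disjoint (true  ∷ X) (false ∷ Y) eq = cong suc (∣∪∣-disjoint X Y (∷-injectiveʳ eq))
  ∣∪∣-disjoint (false ∷ X) (true  ∷ Y) eq =
    trans (cong suc (∣∪∣-disjoint X Y (∷-injectiveʳ eq))) (sym (+-suc ∣ X ∣ ∣ Y ∣))
  ∣∪∣-disjoint (false ∷ X) (false ∷ Y) eq = ∣∪∣-disjoint X Y (∷-injectiveʳ eq)

  ∣∣≡0⇒≡⊥ : ∀ {n} (p : Subset n) → ∣ p ∣ ≡ 0 → p ≡ ⊥
  ∣∣≡0⇒≡⊥ []          _  = refl
  ∣∣≡0⇒≡⊥ (false ∷ p) eq = cong (false ∷_) (∣∣≡0⇒≡⊥ p eq)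

  ∣∣-partition : ∀ {n} (p q : Subset n) → ∣ p ∣ ≡ ∣ p ∩ q ∣ + ∣ p ─ q ∣
  ∣∣-partition []          []          = refl
  ∣∣-partition (true  ∷ p) (true  ∷ q) = cong suc (∣∣-partition p q)
  ∣∣-partition (true  ∷ p) (false ∷ q) = trans (cong suc (∣∣-partition p q)) (sym (+-suc _ _))
  ∣∣-partition (false ∷ p) (true  ∷ q) = ∣∣-partition p q
  ∣∣-partition (false ∷ p) (false ∷ q) = ∣∣-partition p q

  ∣∩⁅⁆∣ : ∀ {n} (p : Subset n) i → ∣ p ∩ ⁅ i ⁆ ∣ ≡ 𝟙 (lookup p i)
  ∣∩⁅⁆∣ {suc n} (x ∷ p) zero = trans (∣∣-∷ (x ∧ true) (p ∩ ⊥))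
    (trans (cong₂ _+_ (cong 𝟙 (∧-identityʳ x)) (trans (cong ∣_∣ (∩-zeroʳ p)) (∣⊥∣≡0 n))) (+-identityʳ (𝟙 x)))
  ∣∩⁅⁆∣ (true  ∷ p) (suc i) = ∣∩⁅⁆∣ p i
  ∣∩⁅⁆∣ (false ∷ p) (suc i) = ∣∩⁅⁆∣ p i

  ─⁅⁆≡⊥⇒≡⁅⁆ : ∀ {n} (p : Subset n) i → lookup p i ≡ true → p ─ ⁅ i ⁆ ≡ ⊥ → p ≡ ⁅ i ⁆
  ─⁅⁆≡⊥⇒≡⁅⁆ (x ∷ p) zero    refl eq = cong (true ∷_) (trans (sym (p─⊥≡p p)) (∷-injectiveʳ eq))
  ─⁅⁆≡⊥⇒≡⁅⁆ (x ∷ p) (suc i) p[i] eq =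
    cong₂ _∷_ (∷-injectiveˡ eq) (─⁅⁆≡⊥⇒≡⁅⁆ p i p[i] (∷-injectiveʳ eq))

  sizedIn : ∀ {n} → Subset n → Subset n → ℕ → ℕ
  sizedIn S B j = 𝟙 ((∣ S ─ B ∣ ≡ᵇ 0) ∧ (∣ S ∣ ≡ᵇ j))

  private
    ∧-not-∩ : ∀ s a b → (s ∧ not b) ∧ (s ∧ not a) ≡ s ∧ not (a ∨ b)
    ∧-not-∩ false a     b = refl
    ∧-not-∩ true  true  b = ∧-zeroʳ (not b)
    ∧-not-∩ true  false b = ∧-identityʳ (not b)

  ─∩─ : ∀ {n} (S A B : Subset n) → (S ─ B) ∩ (S ─ A) ≡ S ─ (A ∪ B)
  ─∩─ S A B = ≡-by-lookup λ i → begin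
    lookup ((S ─ B) ∩ (S ─ A)) i                 ≡⟨ lookup-∩ (S ─ B) (S ─ A) i ⟩
    lookup (S ─ B) i ∧ lookup (S ─ A) i          ≡⟨ cong₂ _∧_ (lookup-─ S B i) (lookup-─ S A i) ⟩
    (lookup S i ∧ not (lookup B i)) ∧ (lookup S i ∧ not (lookup A i))
                                                 ≡⟨ ∧-not-∩ (lookup S i) (lookup A i) (lookup B i) ⟩
    lookup S i ∧ not (lookup A i ∨ lookup B i)   ≡⟨ cong (λ z → lookup S i ∧ not z) (lookup-∪ A B i) ⟨
    lookup S i ∧ not (lookup (A ∪ B) i)          ≡⟨ lookup-─ S (A ∪ B) i ⟨
    lookup (S ─ (A ∪ B)) i                       ∎
    where open ≡-Reasoning

  ∣∣-split : ∀ {n} {A B : Subset n} (S : Subset n) → A ∩ B ≡ ⊥ → S ─ (A ∪ B) ≡ ⊥ →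
    ∣ S ∣ ≡ ∣ S ─ B ∣ + ∣ S ─ A ∣
  ∣∣-split {A = A} {B} S A∩B≡⊥ S⊆A∪B = begin
    ∣ S ∣                       ≡⟨ cong ∣_∣ (─∪─-cover S A∩B≡⊥) ⟨
    ∣ (S ─ B) ∪ (S ─ A) ∣       ≡⟨ ∣∪∣-disjoint (S ─ B) (S ─ A) (trans (─∩─ S A B) S⊆A∪B) ⟩
    ∣ S ─ B ∣ + ∣ S ─ A ∣       ∎
    where open ≡-Reasoning

  sizedIn-⋆ : ∀ {n} {A B : Subset n} (S : Subset n) → A ∩ B ≡ ⊥ → ∀ j →
    ((λ i → sizedIn (S ─ B) A i) ⋆ (λ i → sizedIn (S ─ A) B i)) j ≡ sizedIn S (A ∪ B) j
  sizedIn-⋆ {A = A} {B} S A∩B≡⊥ j = begin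
    ((λ i → sizedIn (S ─ B) A i) ⋆ (λ i → sizedIn (S ─ A) B i)) j
      ≡⟨ sumUpTo-cong _ _ j (λ i _ →
           cong₂ (λ X Y → 𝟙 ((∣ X ∣ ≡ᵇ 0) ∧ (∣ S ─ B ∣ ≡ᵇ i)) * 𝟙 ((∣ Y ∣ ≡ᵇ 0) ∧ (∣ S ─ A ∣ ≡ᵇ j ∸ i)))
                 (trans (p─q─r≡p─q∪r S B A) (cong (S ─_) (∪-comm B A))) (p─q─r≡p─q∪r S A B)) ⟩
    sumUpTo (λ i → 𝟙 (covered ∧ (∣ S ─ B ∣ ≡ᵇ i)) * 𝟙 (covered ∧ (∣ S ─ A ∣ ≡ᵇ j ∸ i))) j
      ≡⟨ guarded covered ⟩
    𝟙 (covered ∧ (∣ S ─ B ∣ + ∣ S ─ A ∣ ≡ᵇ j))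
      ≡⟨ cong 𝟙 split ⟩
    sizedIn S (A ∪ B) j ∎
    where
    open ≡-Reasoning
    covered : Bool
    covered = ∣ S ─ (A ∪ B) ∣ ≡ᵇ 0
    guarded : ∀ g → sumUpTo (λ i → 𝟙 (g ∧ (∣ S ─ B ∣ ≡ᵇ i)) * 𝟙 (g ∧ (∣ S ─ A ∣ ≡ᵇ j ∸ i))) j
                  ≡ 𝟙 (g ∧ (∣ S ─ B ∣ + ∣ S ─ A ∣ ≡ᵇ j))
    guarded true  = 𝟙≡ᵇ-⋆ ∣ S ─ B ∣ ∣ S ─ A ∣ j
    guarded false = sumUpTo-zero j
    split : covered ∧ (∣ S ─ B ∣ + ∣ S ─ A ∣ ≡ᵇ j) ≡ covered ∧ (∣ S ∣ ≡ᵇ j)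
    split with ∣ S ─ (A ∪ B) ∣ in eq
    ... | zero  = cong (_≡ᵇ j) (sym (∣∣-split S A∩B≡⊥ (∣∣≡0⇒≡⊥ _ eq)))
    ... | suc _ = refl


  sizedIn-oversized : ∀ {n} (S B : Subset n) {j} → ∣ B ∣ < j → sizedIn S B j ≡ 0
  sizedIn-oversized S B {j} ∣B∣<j =
    cong 𝟙 (dec-false ((∣ S ─ B ∣ ≟ 0) ×-dec (∣ S ∣ ≟ j))
                      λ (S⊆B , ∣S∣≡j) → <⇒≢ (≤-<-trans (∣S∣≤∣B∣ S⊆B) ∣B∣<j) ∣S∣≡j)
    where
    ∣S∣≤∣B∣ : ∣ S ─ B ∣ ≡ 0 → ∣ S ∣ ≤ ∣ B ∣
    ∣S∣≤∣B∣ S⊆B = subst (_≤ ∣ B ∣) (sym (trans (∣∣-partition S B) (trans (cong (∣ S ∩ B ∣ +_) S⊆B) (+-identityʳ _))))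
                        (∣p∩q∣≤∣q∣ S B)

  sizedIn-empty : ∀ {n} (S B : Subset n) (⊥≟S : Dec (⊥ ≡ S)) → 𝟙 (does ⊥≟S) ≡ sizedIn S B 0
  sizedIn-empty {n} S B ⊥≟S = cong 𝟙 (does-⇔ (mk⇔ (λ { refl → ∣⊥─B∣≡0 , ∣⊥∣≡0 n })
                                                  (λ (_ , ∣S∣≡0) → sym (∣∣≡0⇒≡⊥ S ∣S∣≡0)))
                                          ⊥≟S ((∣ S ─ B ∣ ≟ 0) ×-dec (∣ S ∣ ≟ 0)))
    where
    ∣⊥─B∣≡0 : ∣ ⊥ ─ B ∣ ≡ 0
    ∣⊥─B∣≡0 = n≤0⇒n≡0 (subst (∣ ⊥ ─ B ∣ ≤_) (∣⊥∣≡0 n) (∣p─q∣≤∣p∣ ⊥ B))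

  lookup-⁅i⁆-i : ∀ {n} (i : Fin n) → lookup ⁅ i ⁆ i ≡ true
  lookup-⁅i⁆-i zero    = refl
  lookup-⁅i⁆-i (suc i) = lookup-⁅i⁆-i i

  ∣∣-point : ∀ {n} (S : Subset n) i → ∣ S ∣ ≡ 𝟙 (lookup S i) + ∣ S ─ ⁅ i ⁆ ∣
  ∣∣-point S i = trans (∣∣-partition S ⁅ i ⁆) (cong (_+ ∣ S ─ ⁅ i ⁆ ∣) (∣∩⁅⁆∣ S i))

  ∣─∣-insert : ∀ {n} (S B : Subset n) i {b} → lookup S i ≡ b → lookup B i ≡ false →
    ∣ S ─ B ∣ ≡ 𝟙 b + ∣ S ─ (⁅ i ⁆ ∪ B) ∣
  ∣─∣-insert S B i {b} S[i] B[i] = begin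
    ∣ S ─ B ∣                                   ≡⟨ ∣∣-point (S ─ B) i ⟩
    𝟙 (lookup (S ─ B) i) + ∣ S ─ B ─ ⁅ i ⁆ ∣     ≡⟨ cong₂ (λ b X → 𝟙 b + ∣ X ∣) S─B[i] S─B─⁅i⁆ ⟩
    𝟙 b + ∣ S ─ (⁅ i ⁆ ∪ B) ∣                   ∎
    where
    open ≡-Reasoning
    S─B[i] : lookup (S ─ B) i ≡ b
    S─B[i] = trans (lookup-─ S B i) (trans (cong₂ (λ a b → a ∧ not b) S[i] B[i]) (∧-identityʳ b))
    S─B─⁅i⁆ : S ─ B ─ ⁅ i ⁆ ≡ S ─ (⁅ i ⁆ ∪ B)
    S─B─⁅i⁆ = trans (p─q─r≡p─q∪r S B ⁅ i ⁆) (cong (S ─_) (∪-comm B ⁅ i ⁆))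

  p─p∪q≡⊥ : ∀ {n} (p q : Subset n) → p ─ (p ∪ q) ≡ ⊥
  p─p∪q≡⊥ []          []          = refl
  p─p∪q≡⊥ (true  ∷ p) (y     ∷ q) = cong (false ∷_) (p─p∪q≡⊥ p q)
  p─p∪q≡⊥ (false ∷ p) (true  ∷ q) = cong (false ∷_) (p─p∪q≡⊥ p q)
  p─p∪q≡⊥ (false ∷ p) (false ∷ q) = cong (false ∷_) (p─p∪q≡⊥ p q)

  sizedIn-cong : ∀ {n} (S : Subset n) {B B′} j → ∣ S ─ B ∣ ≡ ∣ S ─ B′ ∣ → sizedIn S B j ≡ sizedIn S B′ j
  sizedIn-cong S j eq = cong (λ m → 𝟙 ((m ≡ᵇ 0) ∧ (∣ S ∣ ≡ᵇ j))) eq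

  sizedIn-outside : ∀ {n} (S B : Subset n) {m} j → ∣ S ─ B ∣ ≡ suc m → sizedIn S B j ≡ 0
  sizedIn-outside S B j eq = cong (λ m → 𝟙 ((m ≡ᵇ 0) ∧ (∣ S ∣ ≡ᵇ j))) eq

  sizedIn-⊤ : ∀ {n} (S : Subset n) j → sizedIn S ⊤ j ≡ 𝟙 (∣ S ∣ ≡ᵇ j)
  sizedIn-⊤ {n} S j = cong (λ m → 𝟙 ((m ≡ᵇ 0) ∧ (∣ S ∣ ≡ᵇ j))) (trans (cong ∣_∣ (p─⊤≡⊥ S)) (∣⊥∣≡0 n))

  sizedIn-insert : ∀ {n} (S B : Subset n) i (⁅i⁆≟S : Dec (⁅ i ⁆ ≡ S)) → lookup B i ≡ false →
    𝟙 (does ⁅i⁆≟S) + sizedIn S B 1 ≡ sizedIn S (⁅ i ⁆ ∪ B) 1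
  sizedIn-insert {n} S B i ⁅i⁆≟S B[i] with lookup S i in S[i]
  ... | false = cong₂ _+_
    (cong 𝟙 (dec-false ⁅i⁆≟S λ { refl → case trans (sym S[i]) (lookup-⁅i⁆-i i) of λ () }))
    (sizedIn-cong S 1 (∣─∣-insert S B i S[i] B[i]))
  ... | true = begin
    𝟙 (does ⁅i⁆≟S) + sizedIn S B 1
      ≡⟨ cong₂ _+_ (cong 𝟙 (does-⇔ singleton ⁅i⁆≟S ((∣ S ─ (⁅ i ⁆ ∪ B) ∣ ≟ 0) ×-dec (∣ S ∣ ≟ 1))))
                   (sizedIn-outside S B 1 (∣─∣-insert S B i S[i] B[i])) ⟩
    sizedIn S (⁅ i ⁆ ∪ B) 1 + 0
      ≡⟨ +-identityʳ _ ⟩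
    sizedIn S (⁅ i ⁆ ∪ B) 1 ∎
    where
    open ≡-Reasoning
    S─⁅i⁆≡⊥ : ∣ S ∣ ≡ 1 → S ─ ⁅ i ⁆ ≡ ⊥
    S─⁅i⁆≡⊥ ∣S∣≡1 = ∣∣≡0⇒≡⊥ (S ─ ⁅ i ⁆) (suc-injective (begin
      suc ∣ S ─ ⁅ i ⁆ ∣               ≡⟨ cong (λ b → 𝟙 b + ∣ S ─ ⁅ i ⁆ ∣) S[i] ⟨
      𝟙 (lookup S i) + ∣ S ─ ⁅ i ⁆ ∣  ≡⟨ ∣∣-point S i ⟨
      ∣ S ∣                           ≡⟨ ∣S∣≡1 ⟩
      1                               ∎))
    singleton : (⁅ i ⁆ ≡ S) ⇔ (∣ S ─ (⁅ i ⁆ ∪ B) ∣ ≡ 0 × ∣ S ∣ ≡ 1)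
    singleton = mk⇔ (λ { refl → trans (cong ∣_∣ (p─p∪q≡⊥ ⁅ i ⁆ B)) (∣⊥∣≡0 n) , ∣⁅x⁆∣≡1 i })
                    (λ (_ , ∣S∣≡1) → sym (─⁅⁆≡⊥⇒≡⁅⁆ S i S[i] (S─⁅i⁆≡⊥ ∣S∣≡1)))

module Choices (t : Data.Nat.ℕ) where

  open import Data.Bool using (Bool; true; false; _∧_; _∨_; T)
  open import Data.Bool.ListAction using (any)
  import Data.Bool.Properties as Bool
  open import Data.Nat
  open import Data.Nat.Properties
  open import Data.Fin as Fin using (Fin; toℕ)
  import Data.Fin.Properties as Fin
  open import Data.Fin.Subset using (Subset; ∣_∣; _∪_; _∩_; _─_; ⊥; ⊤; ⁅_⁆; _⊆_)
  open import Data.Fin.Subset.Properties using (∣⁅x⁆∣≡1; ∣⊥∣≡0)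
  open import Data.List using (List; []; _∷_; [_]; _++_; map; concatMap; length; filterᵇ; applyUpTo; upTo)
  open import Data.List.Properties using (map-applyUpTo)
  open import Data.List.Relation.Unary.All using (All; []; _∷_)
  import Data.List.Relation.Unary.All as All
  open import Data.List.Relation.Unary.All.Properties using (map⁺; concat⁺; applyUpTo⁺₁)
  open import Data.Product using (_×_; _,_)
  import Data.Rational as ℚ
  open import Data.Sum using (_⊎_; inj₁; inj₂)
  open import Data.Vec using (lookup; tabulate)
  open import Data.Vec.Properties using (≡-dec; lookup∘tabulate)
  open import Function.Bundles using (_⇔_; mk⇔)
  open import Relation.Nullary using (Dec; yes; no; does; ¬_; _×-dec_; _⊎-dec_)
  open import Relation.Nullary.Decidable using (does-⇔; dec-true; dec-false)
  open import Relation.Binary.PropositionalEquality hiding ([_])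
  open import Defs
  open Fraction using (frac-*)
  open Counting
  open SubsetProperties
  open ℕSum

  pos : Fin t → ℕ
  pos i = suc (toℕ i)

  InRange : ℕ → ℕ → ℕ → Set
  InRange o n x = o < x × x ≤ o + n

  inRange? : ∀ o n x → Dec (InRange o n x)
  inRange? o n x = o <? x ×-dec x ≤? o + n

  block : ℕ → ℕ → Subset t
  block o n = tabulate (λ i → does (inRange? o n (pos i)))

  InRange-+ : ∀ o m n x → InRange o (m + n) x ⇔ (InRange o m x ⊎ InRange (o + m) n x)
  InRange-+ o m n x = mk⇔ split join
    where
    split : InRange o (m + n) x → InRange o m x ⊎ InRange (o + m) n x
    split (o<x , x≤o+m+n) with x ≤? o + m
    ... | yes x≤o+m = inj₁ (o<x , x≤o+m)
    ... | no  x≰o+m = inj₂ (≰⇒> x≰o+m , subst (x ≤_) (sym (+-assoc o m n)) x≤o+m+n)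
    join : InRange o m x ⊎ InRange (o + m) n x → InRange o (m + n) x
    join (inj₁ (o<x , x≤o+m)) = o<x , ≤-trans x≤o+m (subst (o + m ≤_) (+-assoc o m n) (m≤m+n (o + m) n))
    join (inj₂ (o+m<x , x≤o+m+n)) = ≤-<-trans (m≤m+n o m) o+m<x , subst (x ≤_) (+-assoc o m n) x≤o+m+n

  InRange-disjoint : ∀ o m n x → InRange o m x → ¬ InRange (o + m) n x
  InRange-disjoint o m n x (_ , x≤o+m) (o+m<x , _) = <⇒≱ o+m<x x≤o+m

  lookup-block : ∀ o n i → lookup (block o n) i ≡ does (inRange? o n (pos i))
  lookup-block o n i = lookup∘tabulate _ i

  block-+ : ∀ o m n → block o (m + n) ≡ block o m ∪ block (o + m) n
  block-+ o m n = ≡-by-lookup λ i → begin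
    lookup (block o (m + n)) i                          ≡⟨ lookup-block o (m + n) i ⟩
    does (inRange? o (m + n) (pos i))
      ≡⟨ does-⇔ (InRange-+ o m n (pos i)) (inRange? o (m + n) (pos i))
                (inRange? o m (pos i) ⊎-dec inRange? (o + m) n (pos i)) ⟩
    does (inRange? o m (pos i) ⊎-dec inRange? (o + m) n (pos i))
                                                        ≡⟨ cong₂ _∨_ (lookup-block o m i) (lookup-block (o + m) n i) ⟨
    lookup (block o m) i ∨ lookup (block (o + m) n) i   ≡⟨ lookup-∪ (block o m) _ i ⟨
    lookup (block o m ∪ block (o + m) n) i              ∎
    where open ≡-Reasoning

  block-disjoint : ∀ o m n → block o m ∩ block (o + m) n ≡ ⊥
  block-disjoint o m n = ≡-by-lookup λ i → begin
    lookup (block o m ∩ block (o + m) n) i                ≡⟨ lookup-∩ (block o m) _ i ⟩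
    lookup (block o m) i ∧ lookup (block (o + m) n) i     ≡⟨ cong₂ _∧_ (lookup-block o m i) (lookup-block (o + m) n i) ⟩
    does (inRange? o m (pos i) ×-dec inRange? (o + m) n (pos i))
      ≡⟨ dec-false (inRange? o m (pos i) ×-dec inRange? (o + m) n (pos i))
                   (λ (r₁ , r₂) → InRange-disjoint o m n (pos i) r₁ r₂) ⟩
    false                                                 ≡⟨ lookup-⊥ i ⟨
    lookup ⊥ i                                            ∎
    where open ≡-Reasoning

  block-zero : ∀ o → block o 0 ≡ ⊥
  block-zero o = ≡-by-lookup λ i → trans (lookup-block o 0 i)
    (trans (dec-false (inRange? o 0 (pos i)) (λ (o<x , x≤o+0) → <⇒≱ o<x (subst (pos i ≤_) (+-identityʳ o) x≤o+0)))
           (sym (lookup-⊥ i)))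

  block-all : block 0 t ≡ ⊤
  block-all = ≡-by-lookup λ i → trans (lookup-block 0 t i)
    (trans (dec-true (inRange? 0 t (pos i)) (s≤s z≤n , Fin.toℕ<n i)) (sym (lookup-⊤ i)))

  pos≡pos⇔≡ : ∀ {i j} → pos i ≡ pos j ⇔ j ≡ i
  pos≡pos⇔≡ = mk⇔ (λ eq → sym (Fin.toℕ-injective (suc-injective eq))) (λ { refl → refl })

  InRange-one⇔≡ : ∀ {i j} → InRange (toℕ i) 1 (pos j) ⇔ j ≡ i
  InRange-one⇔≡ {i} {j} = mk⇔
    (λ (i<pos-j , pos-j≤i+1) → Fin.toℕ-injective
       (≤-antisym (s≤s⁻¹ (subst (pos j ≤_) (+-comm (toℕ i) 1) pos-j≤i+1)) (s≤s⁻¹ i<pos-j)))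
    (λ { refl → n<1+n (toℕ i) , ≤-reflexive (+-comm 1 (toℕ i)) })

  block-one : ∀ i → block (toℕ i) 1 ≡ ⁅ i ⁆
  block-one i = ≡-by-lookup λ j → trans (lookup-block (toℕ i) 1 j)
    (trans (does-⇔ InRange-one⇔≡ (inRange? (toℕ i) 1 (pos j)) (j Fin.≟ i)) (sym (lookup-⁅⁆ i j)))

  lookup-toSubset : ∀ xs i → lookup (toSubset t xs) i ≡ any (λ x → x ≡ᵇ pos i) xs
  lookup-toSubset xs i = lookup∘tabulate _ i

  toSubset-single : ∀ i → toSubset t [ pos i ] ≡ ⁅ i ⁆
  toSubset-single i = ≡-by-lookup λ j → trans (lookup-toSubset [ pos i ] j)
    (trans (Bool.∨-identityʳ (pos i ≡ᵇ pos j))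
    (trans (does-⇔ pos≡pos⇔≡ (pos i ≟ pos j) (j Fin.≟ i)) (sym (lookup-⁅⁆ i j))))

  toSubset-++ : ∀ xs ys → toSubset t (xs ++ ys) ≡ toSubset t xs ∪ toSubset t ys
  toSubset-++ xs ys = ≡-by-lookup λ i → trans (lookup-toSubset (xs ++ ys) i)
    (trans (any-++ xs) (sym (trans (lookup-∪ (toSubset t xs) _ i) (cong₂ _∨_ (lookup-toSubset xs i) (lookup-toSubset ys i)))))
    where
    any-++ : ∀ {p} xs → any p (xs ++ ys) ≡ any p xs ∨ any p ys
    any-++ []       = refl
    any-++ {p} (x ∷ xs) = trans (cong (p x ∨_) (any-++ xs)) (sym (Bool.∨-assoc (p x) _ _))

  toSubset-⊆ : ∀ {o n xs} → All (InRange o n) xs → toSubset t xs ⊆ block o n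
  toSubset-⊆ {o} {n} {xs} inRange = lookup⇒⊆ λ i i∈xs →
    trans (lookup-block o n i) (inBlock inRange (trans (sym (lookup-toSubset xs i)) i∈xs))
    where
    inBlock : ∀ {xs i} → All (InRange o n) xs → any (λ x → x ≡ᵇ pos i) xs ≡ true → does (inRange? o n (pos i)) ≡ true
    inBlock {x ∷ xs} {i} (r ∷ rs) hit with x ≡ᵇ pos i in eq
    ... | true  = dec-true (inRange? o n (pos i)) (subst (InRange o n) (≡ᵇ⇒≡ x (pos i) (subst T (sym eq) _)) r)
    ... | false = inBlock rs hit

  InBlock : ℕ → ℕ → System → Set
  InBlock o n F = All (λ I → o < lo I × lo I ≤ hi I × hi I ≤ o + n) F

  elems-InRange : ∀ {o n} I → o < lo I → lo I ≤ hi I → hi I ≤ o + n → All (InRange o n) (elems I)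
  elems-InRange (a , b) o<a a≤b b≤o+n = map⁺ (applyUpTo⁺₁ (λ j → j) (suc (b ∸ a)) λ {j} j<size →
    <-≤-trans o<a (m≤m+n a j) , ≤-trans (+-monoʳ-≤ a (s≤s⁻¹ j<size)) (≤-trans (≤-reflexive (m+[n∸m]≡n a≤b)) b≤o+n))

  choices-InRange : ∀ {o n} F → InBlock o n F → All (All (InRange o n)) (choices F)
  choices-InRange []      []                          = [] ∷ []
  choices-InRange (I ∷ F) ((o<a , a≤b , b≤o+n) ∷ inF) =
    concat⁺ (map⁺ (All.map (λ r → map⁺ (All.map (r ∷_) (choices-InRange F inF))) (elems-InRange I o<a a≤b b≤o+n)))

  sumBy-choices-++ : ∀ (h : List ℕ → ℕ) F₁ F₂ →
    sumBy h (choices (F₁ ++ F₂)) ≡ sumBy (λ xs → sumBy (λ ys → h (xs ++ ys)) (choices F₂)) (choices F₁)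
  sumBy-choices-++ h []      F₂ = sym (+-identityʳ _)
  sumBy-choices-++ h (I ∷ F) F₂ = begin
    sumBy h (concatMap (λ x → map (x ∷_) (choices (F ++ F₂))) (elems I))
      ≡⟨ sumBy-concatMap h (λ x → map (x ∷_) (choices (F ++ F₂))) (elems I) ⟩
    sumBy (λ x → sumBy h (map (x ∷_) (choices (F ++ F₂)))) (elems I)
      ≡⟨ sumBy-cong (elems I) (λ x → trans (sumBy-map h (x ∷_) (choices (F ++ F₂)))
                                           (sumBy-choices-++ (λ zs → h (x ∷ zs)) F F₂)) ⟩
    sumBy (λ x → sumBy (λ xs → H (x ∷ xs)) (choices F)) (elems I)
      ≡⟨ sumBy-cong (elems I) (λ x → sumBy-map H (x ∷_) (choices F)) ⟨
    sumBy (λ x → sumBy H (map (x ∷_) (choices F))) (elems I)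
      ≡⟨ sumBy-concatMap H (λ x → map (x ∷_) (choices F)) (elems I) ⟨
    sumBy H (concatMap (λ x → map (x ∷_) (choices F)) (elems I)) ∎
    where
    open ≡-Reasoning
    H : List ℕ → ℕ
    H xs = sumBy (λ ys → h (xs ++ ys)) (choices F₂)

  numChoices-++ : ∀ F₁ F₂ → numChoices (F₁ ++ F₂) ≡ numChoices F₁ * numChoices F₂
  numChoices-++ []      F₂ = sym (+-identityʳ _)
  numChoices-++ (I ∷ F) F₂ = trans (cong (size I *_) (numChoices-++ F F₂)) (sym (*-assoc (size I) (numChoices F) (numChoices F₂)))

  _≟ₛ_ : (S T : Subset t) → Dec (S ≡ T)
  _≟ₛ_ = ≡-dec Bool._≟_

  hits : System → Subset t → ℕ
  hits F S = length (filterᵇ (λ xs → does (toSubset t xs ≟ₛ S)) (choices F))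

  hit : Subset t → List ℕ → ℕ
  hit S xs = 𝟙 (does (toSubset t xs ≟ₛ S))

  hits≡sumBy-hit : ∀ F S → hits F S ≡ sumBy (hit S) (choices F)
  hits≡sumBy-hit F S = length-filterᵇ _ (choices F)

  hits-++ : ∀ {o m n} F₁ F₂ S → InBlock o m F₁ → InBlock (o + m) n F₂ →
    hits (F₁ ++ F₂) S ≡ hits F₁ (S ─ block (o + m) n) * hits F₂ (S ─ block o m)
  hits-++ {o} {m} {n} F₁ F₂ S in₁ in₂ = begin
    hits (F₁ ++ F₂) S
      ≡⟨ hits≡sumBy-hit (F₁ ++ F₂) S ⟩
    sumBy (hit S) (choices (F₁ ++ F₂))
      ≡⟨ sumBy-choices-++ (hit S) F₁ F₂ ⟩
    sumBy (λ xs → sumBy (λ ys → hit S (xs ++ ys)) (choices F₂)) (choices F₁)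
      ≡⟨ sumBy-sumBy-* (λ xs ys → hit S (xs ++ ys)) (hit S₁) (hit S₂)
           (choices-InRange F₁ in₁) (choices-InRange F₂ in₂) factor ⟩
    sumBy (hit S₁) (choices F₁) * sumBy (hit S₂) (choices F₂)
      ≡⟨ cong₂ _*_ (hits≡sumBy-hit F₁ S₁) (hits≡sumBy-hit F₂ S₂) ⟨
    hits F₁ S₁ * hits F₂ S₂ ∎
    where
    open ≡-Reasoning
    S₁ : Subset t
    S₁ = S ─ block (o + m) n
    S₂ : Subset t
    S₂ = S ─ block o m
    factor : ∀ {xs ys} → All (InRange o m) xs → All (InRange (o + m) n) ys → hit S (xs ++ ys) ≡ hit S₁ xs * hit S₂ ys
    factor {xs} {ys} r₁ r₂ =
      trans (cong 𝟙 (does-⇔ split (toSubset t (xs ++ ys) ≟ₛ S) (toSubset t xs ≟ₛ S₁ ×-dec toSubset t ys ≟ₛ S₂)))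
                                   (𝟙-∧ (does (toSubset t xs ≟ₛ S₁)) (does (toSubset t ys ≟ₛ S₂)))
      where
      split : (toSubset t (xs ++ ys) ≡ S) ⇔ (toSubset t xs ≡ S₁ × toSubset t ys ≡ S₂)
      split = subst (λ Z → (Z ≡ S) ⇔ (toSubset t xs ≡ S₁ × toSubset t ys ≡ S₂)) (sym (toSubset-++ xs ys))
                    (∪≡⇔─ S (toSubset-⊆ r₁) (toSubset-⊆ r₂) (block-disjoint o m n))

  block-suc : ∀ i n → block (toℕ i) (suc n) ≡ ⁅ i ⁆ ∪ block (pos i) n
  block-suc i n = begin
    block (toℕ i) (1 + n)                      ≡⟨ block-+ (toℕ i) 1 n ⟩
    block (toℕ i) 1 ∪ block (toℕ i + 1) n      ≡⟨ cong₂ (λ B o → B ∪ block o n) (block-one i) (+-comm (toℕ i) 1) ⟩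
    ⁅ i ⁆ ∪ block (pos i) n                    ∎
    where open ≡-Reasoning

  pos∉block-pos : ∀ i n → lookup (block (pos i) n) i ≡ false
  pos∉block-pos i n = trans (lookup-block (pos i) n i) (dec-false (inRange? (pos i) n (pos i)) (λ (i<i , _) → n≮n (pos i) i<i))

  hits-singletons : ∀ o n (f : ℕ → ℕ) S → (∀ j → f j ≡ suc (o + j)) → o + n ≤ t →
    sumBy (λ x → hit S [ x ]) (applyUpTo f n) ≡ sizedIn S (block o n) 1
  hits-singletons o zero    f S f≗ o+n≤t =
    sym (trans (cong (λ B → sizedIn S B 1) (block-zero o)) (sizedIn-oversized S ⊥ (subst (_< 1) (sym (∣⊥∣≡0 t)) (s≤s z≤n))))
  hits-singletons o (suc n) f S f≗ o+n≤t = begin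
    hit S [ f 0 ] + sumBy (λ x → hit S [ x ]) (applyUpTo (λ j → f (suc j)) n)
      ≡⟨ cong₂ _+_ (cong (λ x → hit S [ x ]) f0≡pos-i) rest ⟩
    hit S [ pos i ] + sizedIn S (block (pos i) n) 1
      ≡⟨ cong (λ X → 𝟙 (does (X ≟ₛ S)) + sizedIn S (block (pos i) n) 1) (toSubset-single i) ⟩
    𝟙 (does (⁅ i ⁆ ≟ₛ S)) + sizedIn S (block (pos i) n) 1
      ≡⟨ sizedIn-insert S (block (pos i) n) i (⁅ i ⁆ ≟ₛ S) (pos∉block-pos i n) ⟩
    sizedIn S (⁅ i ⁆ ∪ block (pos i) n) 1
      ≡⟨ cong (λ B → sizedIn S B 1) (block-suc i n) ⟨
    sizedIn S (block (toℕ i) (suc n)) 1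
      ≡⟨ cong (λ o → sizedIn S (block o (suc n)) 1) toℕ-i ⟩
    sizedIn S (block o (suc n)) 1 ∎
    where
    open ≡-Reasoning
    o<t : o < t
    o<t = <-≤-trans (subst (o <_) (sym (+-suc o n)) (s≤s (m≤m+n o n))) o+n≤t
    i : Fin t
    i = Fin.fromℕ< o<t
    toℕ-i : toℕ i ≡ o
    toℕ-i = Fin.toℕ-fromℕ< o<t
    f0≡pos-i : f 0 ≡ pos i
    f0≡pos-i = trans (f≗ 0) (cong suc (trans (+-identityʳ o) (sym toℕ-i)))
    rest : sumBy (λ x → hit S [ x ]) (applyUpTo (λ j → f (suc j)) n) ≡ sizedIn S (block (pos i) n) 1
    rest = trans (hits-singletons (suc o) n (λ j → f (suc j)) S (λ j → trans (f≗ (suc j)) (cong suc (+-suc o j)))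
                                  (subst (_≤ t) (+-suc o n) o+n≤t))
                 (cong (λ o → sizedIn S (block (suc o) n) 1) (sym toℕ-i))

  span : ℕ → ℕ → Interval
  span o n = (suc o , o + n)

  size-span : ∀ o n → 1 ≤ n → size (span o n) ≡ n
  size-span o (suc n) _ = cong suc (trans (cong (_∸ suc o) (+-suc o n)) (m+n∸m≡n o n))

  hits-span : ∀ o n S → 1 ≤ n → o + n ≤ t → hits [ span o n ] S ≡ sizedIn S (block o n) 1
  hits-span o n S 1≤n o+n≤t = begin
    hits [ span o n ] S
      ≡⟨ hits≡sumBy-hit [ span o n ] S ⟩
    sumBy (hit S) (concatMap (λ x → map (x ∷_) [ [] ]) (elems (span o n)))
      ≡⟨ sumBy-concatMap (hit S) (λ x → map (x ∷_) [ [] ]) (elems (span o n)) ⟩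
    sumBy (λ x → hit S [ x ] + 0) (elems (span o n))
      ≡⟨ sumBy-cong (elems (span o n)) (λ x → +-identityʳ (hit S [ x ])) ⟩
    sumBy (λ x → hit S [ x ]) (map (suc o +_) (upTo (size (span o n))))
      ≡⟨ cong (λ l → sumBy (λ x → hit S [ x ]) l) (map-applyUpTo (λ j → j) (suc o +_) (size (span o n))) ⟩
    sumBy (λ x → hit S [ x ]) (applyUpTo (suc o +_) (size (span o n)))
      ≡⟨ cong (λ m → sumBy (λ x → hit S [ x ]) (applyUpTo (suc o +_) m)) (size-span o n 1≤n) ⟩
    sumBy (λ x → hit S [ x ]) (applyUpTo (suc o +_) n)
      ≡⟨ hits-singletons o n (suc o +_) S (λ _ → refl) o+n≤t ⟩
    sizedIn S (block o n) 1 ∎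
    where open ≡-Reasoning

  toSubset-[] : toSubset t [] ≡ ⊥
  toSubset-[] = ≡-by-lookup λ i → trans (lookup-toSubset [] i) (sym (lookup-⊥ i))

  hits-[] : ∀ S B → hits [] S ≡ sizedIn S B 0
  hits-[] S B = trans (hits≡sumBy-hit [] S) (trans (+-identityʳ (hit S []))
    (trans (cong (λ X → 𝟙 (does (X ≟ₛ S))) toSubset-[]) (sizedIn-empty S B (⊥ ≟ₛ S))))

  ∣block-one∣ : ∀ o → o < t → ∣ block o 1 ∣ ≡ 1
  ∣block-one∣ o o<t = subst (λ o → ∣ block o 1 ∣ ≡ 1) (Fin.toℕ-fromℕ< o<t)
    (trans (cong ∣_∣ (block-one (Fin.fromℕ< o<t))) (∣⁅x⁆∣≡1 (Fin.fromℕ< o<t)))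

  probSets-++ : ∀ {o m n} F₁ F₂ S → InBlock o m F₁ → InBlock (o + m) n F₂ →
    probSets t (F₁ ++ F₂) S ≡ probSets t F₁ (S ─ block (o + m) n) ℚ.* probSets t F₂ (S ─ block o m)
  probSets-++ {o} {m} {n} F₁ F₂ S in₁ in₂ =
    trans (cong₂ frac (hits-++ F₁ F₂ S in₁ in₂) (numChoices-++ F₁ F₂))
          (sym (frac-* (hits F₁ (S ─ block (o + m) n)) (hits F₂ (S ─ block o m)) (numChoices F₁) (numChoices F₂)))

module Powers where

  open import Data.Nat
  open import Data.Nat.Properties
  open import Data.Nat.Tactic.RingSolver using (solve-∀)
  open import Data.Product using (Σ; _×_; _,_)
  open import Relation.Nullary using (yes; no)
  open import Relation.Binary.PropositionalEquality

  2^-suc : ∀ d → 2 ^ suc d ≡ 2 ^ d + 2 ^ d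
  2^-suc d = cong (2 ^ d +_) (+-identityʳ (2 ^ d))

  dyadicScale : ∀ m x → 1 ≤ x → x ≤ 2 ^ m → Σ ℕ λ c → c ≤ m × x * 2 ^ c ≤ 2 ^ m × 2 ^ m < 2 * x * 2 ^ c
  dyadicScale zero    x 1≤x x≤1 rewrite ≤-antisym x≤1 1≤x = 0 , z≤n , ≤-refl , s≤s (s≤s z≤n)
  dyadicScale (suc m) x 1≤x x≤2^m with 2 ^ suc m <? 2 * x
  ... | yes 2^m<2x = 0 , z≤n , subst (_≤ 2 ^ suc m) (sym (*-identityʳ x)) x≤2^m
                           , subst (2 ^ suc m <_) (sym (*-identityʳ (2 * x))) 2^m<2x
  ... | no  2^m≮2x with dyadicScale m x 1≤x (*-cancelˡ-≤ 2 (≮⇒≥ 2^m≮2x))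
  ...   | c , c≤m , lower , upper = suc c , s≤s c≤m
          , subst (_≤ 2 * 2 ^ m) (swap x (2 ^ c)) (*-monoʳ-≤ 2 lower)
          , subst (2 * 2 ^ m <_) (shift x (2 ^ c)) (*-monoʳ-< 2 upper)
    where
    swap : ∀ x y → 2 * (x * y) ≡ x * (2 * y)
    swap = solve-∀
    shift : ∀ x y → 2 * (2 * x * y) ≡ 2 * x * (2 * y)
    shift = solve-∀

module Construction (t c : Data.Nat.ℕ) where

  open import Data.Bool using (Bool; true; false; _∧_; if_then_else_; T)
  open import Data.Bool.Properties using (T-∧)
  open import Data.Nat
  open import Data.Nat.Properties
  open import Data.Nat.DivMod using (_/_; m/n*n≡m)
  open import Data.Nat.Divisibility using (divides)
  open import Data.Nat.Tactic.RingSolver using (solve-∀)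
  open import Data.Fin.Subset using (Subset; _─_; _∪_)
  open import Data.List using (List; []; _∷_; [_]; _++_; length; replicate)
  open import Data.List.Properties using (length-++; length-replicate)
  open import Data.List.Relation.Unary.All using (All; []; _∷_)
  import Data.List.Relation.Unary.All as All
  open import Data.List.Relation.Unary.All.Properties using (++⁺; replicate⁺)
  open import Data.List.Relation.Unary.AllPairs using (AllPairs; []; _∷_)
  import Data.List.Relation.Unary.AllPairs.Properties as AllPairs
  open import Data.Product using (Σ; _×_; _,_)
  import Data.Rational as ℚ
  import Data.Rational.Properties as ℚ
  open import Data.Sum using (_⊎_; inj₁; inj₂)
  open import Function.Bundles using (Equivalence)
  open import Relation.Nullary using (yes; no; contradiction)
  open import Relation.Binary.PropositionalEquality hiding ([_])
  open import Defs
  open Lists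
  open ℕSum
  open Fraction
  open Binomial
  open Counting using (length-concatUpTo; sumBy-const)
  open SubsetProperties using (sizedIn; sizedIn-⋆; sizedIn-oversized)
  open Powers using (2^-suc)
  open Choices t

  -- 2^d copies, so that systems o d j always has C(2^d, j) members
  cap : ℕ → ℕ → List System
  cap o d = replicate (2 ^ d) [ span o (2 ^ d) ]

  isCap : ℕ → ℕ → Bool
  isCap d j = (j ≡ᵇ 1) ∧ (suc d ≤ᵇ c)

  -- The support of the distribution on [2^d, j]-systems on the positions o + 1, …, o + 2^d, as a list of
  -- equally likely systems: a single interval if j = 1 and 2^d ≤ 2^c, and otherwise i intervals in the
  -- left half and j − i in the right half, each i occurring C(2^d/2, i) C(2^d/2, j − i) times.
  systems : ℕ → ℕ → ℕ → List System
  systems o zero    zero          = [ [] ]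
  systems o zero    (suc zero)    = cap o 0
  systems o zero    (suc (suc j)) = []
  systems o (suc d) j             =
    if isCap d j then cap o (suc d) else concatUpTo (λ i → systems o d i ⊗ systems (o + 2 ^ d) d (j ∸ i)) j

  isCap-true : ∀ d j → isCap d j ≡ true → j ≡ 1 × suc d ≤ c
  isCap-true d j eq with Equivalence.to T-∧ (subst T (sym eq) _)
  ... | j≡1 , d<c = ≡ᵇ⇒≡ j 1 j≡1 , ≤ᵇ⇒≤ (suc d) c d<c

  isCap-false : ∀ d → isCap d 1 ≡ false → c ≤ d
  isCap-false d eq = s≤s⁻¹ (≰⇒> λ d<c → subst T eq (≤⇒≤ᵇ d<c))

  DyadicSize : Interval → Set
  DyadicSize I = Σ ℕ λ e → e ≤ c × size I ≡ 2 ^ e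

  WellFormed : ℕ → ℕ → ℕ → System → Set
  WellFormed o d j F = length F ≡ j × InBlock o (2 ^ d) F × AllPairs Disjoint F × All DyadicSize F

  cap-WellFormed : ∀ o d → d ≤ c → All (WellFormed o d 1) (cap o d)
  cap-WellFormed o d d≤c = replicate⁺ (2 ^ d)
    (refl , (≤-refl , lo≤hi , ≤-refl) ∷ [] , [] ∷ [] , (d , d≤c , size-span o (2 ^ d) (m^n>0 2 d)) ∷ [])
    where
    lo≤hi : suc o ≤ o + 2 ^ d
    lo≤hi = subst (_≤ o + 2 ^ d) (+-comm o 1) (+-monoʳ-≤ o (m^n>0 2 d))

  InBlock-weaken : ∀ {o n o′ n′} F → o′ ≤ o → o + n ≤ o′ + n′ → InBlock o n F → InBlock o′ n′ F
  InBlock-weaken F o′≤o end≤end = All.map λ (o<a , a≤b , b≤o+n) → ≤-<-trans o′≤o o<a , a≤b , ≤-trans b≤o+n end≤end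

  WellFormed-++ : ∀ {o d i j F₁ F₂} → i ≤ j → WellFormed o d i F₁ → WellFormed (o + 2 ^ d) d (j ∸ i) F₂ →
    WellFormed o (suc d) j (F₁ ++ F₂)
  WellFormed-++ {o} {d} {i} {j} {F₁} {F₂} i≤j (len₁ , in₁ , dis₁ , dy₁) (len₂ , in₂ , dis₂ , dy₂) =
    trans (length-++ F₁) (trans (cong₂ _+_ len₁ len₂) (m+[n∸m]≡n i≤j)) ,
    ++⁺ (InBlock-weaken F₁ ≤-refl (+-monoʳ-≤ o half≤whole) in₁)
        (InBlock-weaken F₂ (m≤m+n o (2 ^ d)) (≤-reflexive (trans (+-assoc o _ _) (cong (o +_) (sym (2^-suc d))))) in₂) ,
    AllPairs.++⁺ dis₁ dis₂ (All.map (λ (_ , _ , b≤o+N) → All.map (λ (o+N<c , _) → inj₁ (≤-<-trans b≤o+N o+N<c)) in₂) in₁) ,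
    ++⁺ dy₁ dy₂
    where
    half≤whole : 2 ^ d ≤ 2 ^ suc d
    half≤whole = subst (2 ^ d ≤_) (sym (2^-suc d)) (m≤m+n (2 ^ d) (2 ^ d))

  systems-WellFormed : ∀ o d j → All (WellFormed o d j) (systems o d j)
  systems-WellFormed o zero    zero          = (refl , [] , [] , []) ∷ []
  systems-WellFormed o zero    (suc zero)    = cap-WellFormed o 0 z≤n
  systems-WellFormed o zero    (suc (suc j)) = []
  systems-WellFormed o (suc d) j with isCap d j in isCap≡
  ... | true with isCap-true d j isCap≡
  ...   | refl , d<c = cap-WellFormed o (suc d) d<c
  systems-WellFormed o (suc d) j | false =
    All-concatUpTo _ j λ i i≤j → All-⊗ (systems-WellFormed o d i) (systems-WellFormed (o + 2 ^ d) d (j ∸ i)) (WellFormed-++ {d = d} i≤j)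

  length-systems : ∀ o d j → length (systems o d j) ≡ choose (2 ^ d) j
  length-systems o zero    zero          = refl
  length-systems o zero    (suc zero)    = refl
  length-systems o zero    (suc (suc j)) = refl
  length-systems o (suc d) j with isCap d j in isCap≡
  ... | true with isCap-true d j isCap≡
  ...   | refl , _ = trans (length-replicate (2 ^ suc d)) (sym (choose-1 (2 ^ suc d)))
  length-systems o (suc d) j | false = begin
    length (concatUpTo (λ i → systems o d i ⊗ systems (o + N) d (j ∸ i)) j)
      ≡⟨ length-concatUpTo _ j ⟩
    sumUpTo (λ i → length (systems o d i ⊗ systems (o + N) d (j ∸ i))) j
      ≡⟨ sumUpTo-cong _ _ j (λ i _ → trans (length-⊗ (systems o d i) _)
                                         (cong₂ _*_ (length-systems o d i) (length-systems (o + N) d (j ∸ i)))) ⟩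
    (choose N ⋆ choose N) j
      ≡⟨ choose-vandermonde N N j ⟩
    choose (N + N) j
      ≡⟨ cong (λ n → choose n j) (2^-suc d) ⟨
    choose (2 ^ suc d) j ∎
    where
    open ≡-Reasoning
    N : ℕ
    N = 2 ^ d

  probSets-cap : ∀ o d S → o + 2 ^ d ≤ t →
    ℚSum.sumBy (λ F → probSets t F S) (cap o d) ≡ frac (sizedIn S (block o (2 ^ d)) 1) 1
  probSets-cap o d S end≤t = begin
    ℚSum.sumBy (λ F → probSets t F S) (replicate N [ I ])
      ≡⟨ frac-sumBy-replicate (λ F → probSets t F S) N [ I ] (hits [ I ] S) (numChoices [ I ]) refl ⟩
    frac (N * hits [ I ] S) (size I * 1)
      ≡⟨ cong (λ m → frac (N * hits [ I ] S) (m * 1)) (size-span o N (m^n>0 2 d)) ⟩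
    frac (N * hits [ I ] S) (N * 1)
      ≡⟨ frac-cancelˡ N (hits [ I ] S) 1 (m^n>0 2 d) ≤-refl ⟩
    frac (hits [ I ] S) 1
      ≡⟨ cong (λ m → frac m 1) (hits-span o N S (m^n>0 2 d) end≤t) ⟩
    frac (sizedIn S (block o N) 1) 1 ∎
    where
    open ≡-Reasoning
    N : ℕ
    N = 2 ^ d
    I : Interval
    I = span o N

  systems-perfect : ∀ o d j S → o + 2 ^ d ≤ t →
    ℚSum.sumBy (λ F → probSets t F S) (systems o d j) ≡ frac (sizedIn S (block o (2 ^ d)) j) 1
  systems-perfect o zero zero S end≤t =
    trans (ℚ.+-identityʳ (probSets t [] S)) (cong (λ m → frac m 1) (hits-[] S (block o 1)))
  systems-perfect o zero (suc zero) S end≤t = probSets-cap o 0 S end≤t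
  systems-perfect o zero (suc (suc j)) S end≤t = trans (sym (frac-zero 1))
    (cong (λ m → frac m 1) (sym (sizedIn-oversized S (block o 1)
      (≤-trans (≤-reflexive (cong suc (∣block-one∣ o (subst (_≤ t) (+-comm o 1) end≤t)))) (s≤s (s≤s z≤n))))))
  systems-perfect o (suc d) j S end≤t with isCap d j in isCap≡
  ... | true with isCap-true d j isCap≡
  ...   | refl , _ = probSets-cap o (suc d) S end≤t
  systems-perfect o (suc d) j S end≤t | false = begin
    ℚSum.sumBy (λ F → probSets t F S) (concatUpTo (λ i → systems o d i ⊗ systems (o + N) d (j ∸ i)) j)
      ≡⟨ ℚSum.sumBy-concatUpTo _ _ j ⟩
    ℚSum.sumUpTo (λ i → ℚSum.sumBy (λ F → probSets t F S) (systems o d i ⊗ systems (o + N) d (j ∸ i))) j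
      ≡⟨ ℚSum.sumUpTo-cong _ _ j (λ i _ → halves i) ⟩
    ℚSum.sumUpTo (λ i → frac (sizedIn (S ─ B) A i * sizedIn (S ─ A) B (j ∸ i)) 1) j
      ≡⟨ frac-sumUpTo _ 1 j ⟩
    frac (((λ i → sizedIn (S ─ B) A i) ⋆ (λ i → sizedIn (S ─ A) B i)) j) 1
      ≡⟨ cong (λ m → frac m 1) (sizedIn-⋆ S (block-disjoint o N N) j) ⟩
    frac (sizedIn S (A ∪ B) j) 1
      ≡⟨ cong (λ X → frac (sizedIn S X j) 1) (trans (cong (block o) (2^-suc d)) (block-+ o N N)) ⟨
    frac (sizedIn S (block o (2 ^ suc d)) j) 1 ∎
    where
    open ≡-Reasoning
    N : ℕ
    N = 2 ^ d
    A : Subset t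
    A = block o N
    B : Subset t
    B = block (o + N) N
    left≤t : o + N ≤ t
    left≤t = ≤-trans (+-monoʳ-≤ o (subst (N ≤_) (sym (2^-suc d)) (m≤m+n N N))) end≤t
    right≤t : o + N + N ≤ t
    right≤t = subst (_≤ t) (trans (cong (o +_) (2^-suc d)) (sym (+-assoc o N N))) end≤t
    halves : ∀ i → ℚSum.sumBy (λ F → probSets t F S) (systems o d i ⊗ systems (o + N) d (j ∸ i))
                 ≡ frac (sizedIn (S ─ B) A i * sizedIn (S ─ A) B (j ∸ i)) 1
    halves i = begin
      ℚSum.sumBy (λ F → probSets t F S) (systems o d i ⊗ systems (o + N) d (j ∸ i))
        ≡⟨ ℚSum.sumBy-⊗-* _ (λ F → probSets t F (S ─ B)) (λ F → probSets t F (S ─ A))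
             (systems-WellFormed o d i) (systems-WellFormed (o + N) d (j ∸ i))
             (λ (_ , in₁ , _) (_ , in₂ , _) → probSets-++ _ _ S in₁ in₂) ⟩
      ℚSum.sumBy (λ F → probSets t F (S ─ B)) (systems o d i)
        ℚ.* ℚSum.sumBy (λ F → probSets t F (S ─ A)) (systems (o + N) d (j ∸ i))
        ≡⟨ cong₂ ℚ._*_ (systems-perfect o d i (S ─ B) left≤t) (systems-perfect (o + N) d (j ∸ i) (S ─ A) right≤t) ⟩
      frac (sizedIn (S ─ B) A i) 1 ℚ.* frac (sizedIn (S ─ A) B (j ∸ i)) 1
        ≡⟨ frac-* (sizedIn (S ─ B) A i) (sizedIn (S ─ A) B (j ∸ i)) 1 1 ⟩
      frac (sizedIn (S ─ B) A i * sizedIn (S ─ A) B (j ∸ i)) 1 ∎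

  -- 1 / |I| scaled by 2^c, a natural number for the dyadic sizes |I| ≤ 2^c that occur
  intervalValue : Interval → ℕ
  intervalValue I = 2 ^ c / size I

  systemValue : System → ℕ
  systemValue F = sumBy intervalValue F

  intervalValue-*-size : ∀ I → DyadicSize I → intervalValue I * size I ≡ 2 ^ c
  intervalValue-*-size I (e , e≤c , size≡2^e) = m/n*n≡m (divides (2 ^ (c ∸ e)) 2^c≡)
    where
    2^c≡ : 2 ^ c ≡ 2 ^ (c ∸ e) * size I
    2^c≡ = trans (cong (2 ^_) (sym (m∸n+n≡m e≤c)))
                 (trans (^-distribˡ-+-* 2 (c ∸ e) e) (cong (2 ^ (c ∸ e) *_) (sym size≡2^e)))

  val≡systemValue : ∀ F → All DyadicSize F → val F ≡ frac (systemValue F) (2 ^ c)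
  val≡systemValue F dyadic = begin
    val F
      ≡⟨ sumℚ-map (λ I → frac 1 (size I)) F ⟩
    ℚSum.sumBy (λ I → frac 1 (size I)) F
      ≡⟨ ℚSum.sumBy-cong-All dyadic (λ {I} dy →
           frac-reciprocal (intervalValue I) (size I) (2 ^ c) (s≤s z≤n) (m^n>0 2 c) (intervalValue-*-size I dy)) ⟩
    ℚSum.sumBy (λ I → frac (intervalValue I) (2 ^ c)) F
      ≡⟨ frac-sumBy intervalValue (2 ^ c) F ⟩
    frac (systemValue F) (2 ^ c) ∎
    where open ≡-Reasoning

  systemValue-⊗ : ∀ L₁ L₂ →
    sumBy systemValue (L₁ ⊗ L₂) ≡ length L₂ * sumBy systemValue L₁ + length L₁ * sumBy systemValue L₂
  systemValue-⊗ L₁ L₂ = begin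
    sumBy systemValue (L₁ ⊗ L₂)
      ≡⟨ sumBy-⊗ systemValue L₁ L₂ ⟩
    sumBy (λ F₁ → sumBy (λ F₂ → systemValue (F₁ ++ F₂)) L₂) L₁
      ≡⟨ sumBy-cong L₁ (λ F₁ → begin
           sumBy (λ F₂ → systemValue (F₁ ++ F₂)) L₂
             ≡⟨ sumBy-cong L₂ (λ F₂ → sumBy-++ intervalValue F₁ F₂) ⟩
           sumBy (λ F₂ → systemValue F₁ + systemValue F₂) L₂
             ≡⟨ sumBy-+ (λ _ → systemValue F₁) systemValue L₂ ⟩
           sumBy (λ _ → systemValue F₁) L₂ + sumBy systemValue L₂
             ≡⟨ cong (_+ sumBy systemValue L₂) (sumBy-const (systemValue F₁) L₂) ⟩
           length L₂ * systemValue F₁ + sumBy systemValue L₂ ∎) ⟩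
    sumBy (λ F₁ → length L₂ * systemValue F₁ + sumBy systemValue L₂) L₁
      ≡⟨ sumBy-+ (λ F₁ → length L₂ * systemValue F₁) (λ _ → sumBy systemValue L₂) L₁ ⟩
    sumBy (λ F₁ → length L₂ * systemValue F₁) L₁ + sumBy (λ _ → sumBy systemValue L₂) L₁
      ≡⟨ cong₂ _+_ (sumBy-*ˡ (length L₂) systemValue L₁) (sumBy-const (sumBy systemValue L₂) L₁) ⟩
    length L₂ * sumBy systemValue L₁ + length L₁ * sumBy systemValue L₂ ∎
    where open ≡-Reasoning

  scale : ℕ → ℕ
  scale d = 2 ^ d ⊔ 2 ^ c

  -- Divided by 2^d 2^c C(2^d, j), this says that a system drawn from systems o d j has expected
  -- value at most j / min(2^d, 2^c) + 2 d j (j − 1) / 2^d.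
  valueBound : ℕ → ℕ → ℕ
  valueBound d j = j * scale d * choose (2 ^ d) j + 2 * d * 2 ^ c * fallingChoose (2 ^ d) j

  value-cap : ∀ o d → d ≤ c → 2 ^ d * sumBy systemValue (cap o d) ≤ valueBound d 1
  value-cap o d d≤c = begin
    2 ^ d * sumBy systemValue (replicate (2 ^ d) [ I ])  ≡⟨ cong (2 ^ d *_) (sumBy-replicate (2 ^ d)) ⟩
    2 ^ d * (2 ^ d * (intervalValue I + 0))             ≡⟨ cong (λ v → 2 ^ d * (2 ^ d * v)) (+-identityʳ (intervalValue I)) ⟩
    2 ^ d * (2 ^ d * intervalValue I)                   ≡⟨ cong (2 ^ d *_) 2^d*value≡2^c ⟩
    2 ^ d * 2 ^ c                                       ≤⟨ *-monoʳ-≤ (2 ^ d) (m≤n⊔m (2 ^ d) (2 ^ c)) ⟩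
    2 ^ d * scale d                                     ≡⟨ *-comm (2 ^ d) (scale d) ⟩
    scale d * 2 ^ d                                     ≡⟨ cong₂ _*_ (sym (*-identityˡ (scale d))) (sym (choose-1 (2 ^ d))) ⟩
    1 * scale d * choose (2 ^ d) 1                      ≤⟨ m≤m+n _ _ ⟩
    valueBound d 1                                      ∎
    where
    open ≤-Reasoning
    I : Interval
    I = span o (2 ^ d)
    sumBy-replicate : ∀ n → sumBy systemValue (replicate n [ I ]) ≡ n * systemValue [ I ]
    sumBy-replicate zero    = refl
    sumBy-replicate (suc n) = cong (systemValue [ I ] +_) (sumBy-replicate n)
    2^d*value≡2^c : 2 ^ d * intervalValue I ≡ 2 ^ c
    2^d*value≡2^c = trans (*-comm (2 ^ d) _)
      (trans (cong (intervalValue I *_) (sym (size-span o (2 ^ d) (m^n>0 2 d))))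
             (intervalValue-*-size I (d , d≤c , size-span o (2 ^ d) (m^n>0 2 d))))

  scale-doubling : ∀ d j n → c ≤ d ⊎ j ≢ 1 →
    2 * scale d * (j * choose n j) ≤ j * scale (suc d) * choose n j + 2 * 2 ^ c * fallingChoose n j
  scale-doubling d j n small-or-j≢1 with c ≤? d
  ... | yes c≤d rewrite m≥n⇒m⊔n≡m (^-monoʳ-≤ 2 c≤d) | m≥n⇒m⊔n≡m (^-monoʳ-≤ 2 (m≤n⇒m≤1+n c≤d)) =
    ≤-trans (≤-reflexive (regroup (2 ^ d) j (choose n j))) (m≤m+n _ _)
    where
    regroup : ∀ N j C → 2 * N * (j * C) ≡ j * (N + (N + 0)) * C
    regroup = solve-∀
  ... | no c≰d with small-or-j≢1
  ...   | inj₁ c≤d = contradiction c≤d c≰d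
  ...   | inj₂ j≢1
    rewrite m≤n⇒m⊔n≡n (^-monoʳ-≤ 2 (<⇒≤ (≰⇒> c≰d))) | m≤n⇒m⊔n≡n (^-monoʳ-≤ 2 (≰⇒> c≰d)) = begin
    2 * 2 ^ c * (j * choose n j)                            ≡⟨ regroup (2 ^ c) j (choose n j) ⟩
    j * 2 ^ c * choose n j + 2 ^ c * (j * choose n j)       ≤⟨ +-monoʳ-≤ (j * 2 ^ c * choose n j)
                                                                 (*-monoʳ-≤ (2 ^ c) (choose-≤-fallingChoose n j j≢1)) ⟩
    j * 2 ^ c * choose n j + 2 ^ c * (2 * fallingChoose n j) ≡⟨ cong (j * 2 ^ c * choose n j +_) (*-comm (2 ^ c) _ ) ⟩
    j * 2 ^ c * choose n j + 2 * fallingChoose n j * 2 ^ c   ≡⟨ cong (j * 2 ^ c * choose n j +_) (rearrange (fallingChoose n j) (2 ^ c)) ⟩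
    j * 2 ^ c * choose n j + 2 * 2 ^ c * fallingChoose n j   ∎
    where
    open ≤-Reasoning
    regroup : ∀ M j C → 2 * M * (j * C) ≡ j * M * C + M * (j * C)
    regroup = solve-∀
    rearrange : ∀ F M → 2 * F * M ≡ 2 * M * F
    rearrange = solve-∀

  value-halves : ∀ d j (X Y : ℕ → ℕ) → c ≤ d ⊎ j ≢ 1 →
    (∀ i → 2 ^ d * X i ≤ valueBound d i) → (∀ i → 2 ^ d * Y i ≤ valueBound d i) →
    2 ^ suc d * sumUpTo (λ i → choose (2 ^ d) (j ∸ i) * X i + choose (2 ^ d) i * Y (j ∸ i)) j ≤ valueBound (suc d) j
  value-halves d j X Y small-or-j≢1 X≤ Y≤ = begin
    2 ^ suc d * sumUpTo (λ i → C (j ∸ i) * X i + C i * Y (j ∸ i)) j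
      ≡⟨ cong (_* sumUpTo (λ i → C (j ∸ i) * X i + C i * Y (j ∸ i)) j) (2^-suc d) ⟩
    (N + N) * sumUpTo (λ i → C (j ∸ i) * X i + C i * Y (j ∸ i)) j
      ≡⟨ distribute ⟩
    2 * sumUpTo (λ i → C (j ∸ i) * (N * X i) + C i * (N * Y (j ∸ i))) j
      ≤⟨ *-monoʳ-≤ 2 (sumUpTo-mono-≤ _ _ j λ i _ →
           +-mono-≤ (*-monoʳ-≤ (C (j ∸ i)) (X≤ i)) (*-monoʳ-≤ (C i) (Y≤ (j ∸ i)))) ⟩
    2 * sumUpTo (λ i → C (j ∸ i) * valueBound d i + C i * valueBound d (j ∸ i)) j
      ≡⟨ cong (2 *_) collect ⟩
    2 * (M * (j * choose (N + N) j) + D * (P + P))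
      ≤⟨ combine ⟩
    j * scale (suc d) * choose (N + N) j + 2 * suc d * 2 ^ c * fallingChoose (N + N) j
      ≡⟨ cong (λ n → j * scale (suc d) * choose n j + 2 * suc d * 2 ^ c * fallingChoose n j) (2^-suc d) ⟨
    valueBound (suc d) j ∎
    where
    open ≤-Reasoning
    N : ℕ
    N = 2 ^ d
    C : ℕ → ℕ
    C = choose N
    M : ℕ
    M = scale d
    D : ℕ
    D = 2 * d * 2 ^ c
    P : ℕ
    P = (fallingChoose N ⋆ C) j
    distribute : (N + N) * sumUpTo (λ i → C (j ∸ i) * X i + C i * Y (j ∸ i)) j
               ≡ 2 * sumUpTo (λ i → C (j ∸ i) * (N * X i) + C i * (N * Y (j ∸ i))) j
    distribute = trans (cong (_* total) (cong (N +_) (sym (+-identityʳ N))))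
      (trans (*-assoc 2 N total) (cong (2 *_) (trans (sym (sumUpTo-*ˡ N (λ i → C (j ∸ i) * X i + C i * Y (j ∸ i)) j))
        (sumUpTo-cong _ _ j (λ i _ → spread N (C (j ∸ i)) (X i) (C i) (Y (j ∸ i)))))))
      where
      total : ℕ
      total = sumUpTo (λ i → C (j ∸ i) * X i + C i * Y (j ∸ i)) j
      spread : ∀ n a x b y → n * (a * x + b * y) ≡ a * (n * x) + b * (n * y)
      spread = solve-∀
    collect : sumUpTo (λ i → C (j ∸ i) * valueBound d i + C i * valueBound d (j ∸ i)) j ≡ M * (j * choose (N + N) j) + D * (P + P)
    collect = begin-equality
      sumUpTo (λ i → C (j ∸ i) * valueBound d i + C i * valueBound d (j ∸ i)) j
        ≡⟨ sumUpTo-cong _ _ j (λ i _ → regroup (C (j ∸ i)) i M (C i) D (fallingChoose N i) (j ∸ i) (fallingChoose N (j ∸ i))) ⟩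
      sumUpTo (λ i → M * ((i + (j ∸ i)) * (C i * C (j ∸ i))) + D * (fallingChoose N i * C (j ∸ i) + C i * fallingChoose N (j ∸ i))) j
        ≡⟨ sumUpTo-+ _ _ j ⟩
      sumUpTo (λ i → M * ((i + (j ∸ i)) * (C i * C (j ∸ i)))) j
        + sumUpTo (λ i → D * (fallingChoose N i * C (j ∸ i) + C i * fallingChoose N (j ∸ i))) j
        ≡⟨ cong₂ _+_ (trans (sumUpTo-*ˡ M _ j) (cong (M *_) (choose-⋆-mean N j)))
                     (trans (sumUpTo-*ˡ D _ j) (cong (D *_) (trans (sumUpTo-+ _ _ j) (cong (P +_) (⋆-comm C (fallingChoose N) j))))) ⟩
      M * (j * choose (N + N) j) + D * (P + P) ∎
      where
      regroup : ∀ b′ i m b d q k q′ → b′ * (i * m * b + d * q) + b * (k * m * b′ + d * q′)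
                                    ≡ m * ((i + k) * (b * b′)) + d * (q * b′ + b * q′)
      regroup = solve-∀
    combine : 2 * (M * (j * choose (N + N) j) + D * (P + P)) ≤ j * scale (suc d) * choose (N + N) j + 2 * suc d * 2 ^ c * fallingChoose (N + N) j
    combine = begin
      2 * (M * (j * choose (N + N) j) + D * (P + P))
        ≡⟨ expand M j (choose (N + N) j) d (2 ^ c) P ⟩
      2 * M * (j * choose (N + N) j) + 2 * d * 2 ^ c * (4 * P)
        ≤⟨ +-mono-≤ (scale-doubling d j (N + N) small-or-j≢1) (*-monoʳ-≤ (2 * d * 2 ^ c) (fallingChoose-⋆-≤ N j)) ⟩
      j * scale (suc d) * choose (N + N) j + 2 * 2 ^ c * fallingChoose (N + N) j + 2 * d * 2 ^ c * fallingChoose (N + N) j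
        ≡⟨ merge (j * scale (suc d) * choose (N + N) j) (2 ^ c) (fallingChoose (N + N) j) d ⟩
      j * scale (suc d) * choose (N + N) j + 2 * suc d * 2 ^ c * fallingChoose (N + N) j ∎
      where
      expand : ∀ M j C d c P → 2 * (M * (j * C) + 2 * d * c * (P + P)) ≡ 2 * M * (j * C) + 2 * d * c * (4 * P)
      expand = solve-∀
      merge : ∀ x c Q d → x + 2 * c * Q + 2 * d * c * Q ≡ x + 2 * (1 + d) * c * Q
      merge = solve-∀

  systemValue-halves : ∀ o d j →
    sumBy systemValue (concatUpTo (λ i → systems o d i ⊗ systems (o + 2 ^ d) d (j ∸ i)) j)
    ≡ sumUpTo (λ i → choose (2 ^ d) (j ∸ i) * sumBy systemValue (systems o d i)
                   + choose (2 ^ d) i * sumBy systemValue (systems (o + 2 ^ d) d (j ∸ i))) j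
  systemValue-halves o d j = trans (sumBy-concatUpTo systemValue _ j) (sumUpTo-cong _ _ j λ i _ →
    trans (systemValue-⊗ (systems o d i) (systems (o + 2 ^ d) d (j ∸ i)))
          (cong₂ (λ a b → a * sumBy systemValue (systems o d i) + b * sumBy systemValue (systems (o + 2 ^ d) d (j ∸ i)))
                 (length-systems (o + 2 ^ d) d (j ∸ i)) (length-systems o d i)))

  systems-value : ∀ o d j → 2 ^ d * sumBy systemValue (systems o d j) ≤ valueBound d j
  systems-value o zero    zero          = z≤n
  systems-value o zero    (suc zero)    = value-cap o 0 z≤n
  systems-value o zero    (suc (suc j)) = z≤n
  systems-value o (suc d) j with isCap d j in isCap≡
  ... | true with isCap-true d j isCap≡
  ...   | refl , d<c = value-cap o (suc d) d<c
  systems-value o (suc d) j | false =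
    subst (_≤ valueBound (suc d) j) (cong (2 ^ suc d *_) (sym (systemValue-halves o d j)))
      (value-halves d j _ _ small-or-j≢1 (systems-value o d) (systems-value (o + 2 ^ d) d))
    where
    small-or-j≢1 : c ≤ d ⊎ j ≢ 1
    small-or-j≢1 with j ≟ 1
    ... | yes refl = inj₁ (isCap-false d isCap≡)
    ... | no  j≢1  = inj₂ j≢1

  totalSize-≤ : ∀ F → All DyadicSize F → totalSize F ≤ length F * 2 ^ c
  totalSize-≤ []      []                       = z≤n
  totalSize-≤ (I ∷ F) ((e , e≤c , size≡) ∷ dy) =
    +-mono-≤ (subst (_≤ 2 ^ c) (sym size≡) (^-monoʳ-≤ 2 e≤c)) (totalSize-≤ F dy)

open import Defs
open import Data.Nat using (ℕ; _*_; _^_; _≤_)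
open import Data.Rational using () renaming (_≤_ to _≤ℚ_)
open import Data.Product using (Σ; _×_; _,_)

module Witness {k m : ℕ} (1≤k : 1 ≤ k) (6k≤2^m : 6 * k ≤ 2 ^ m) where

  open import Data.Nat
  open import Data.Nat.Properties
  open import Data.Nat.Tactic.RingSolver using (solve-∀)
  open import Data.Fin.Subset using (∣_∣)
  open import Data.List using (List; map; length)
  open import Data.List.Properties using (map-∘)
  open import Data.List.Relation.Unary.All using (All)
  import Data.List.Relation.Unary.All as All
  open import Data.List.Relation.Unary.All.Properties using (map⁺)
  open import Data.Product using (_,_; proj₁; proj₂)
  import Data.Rational as ℚ
  import Data.Rational.Properties as ℚ
  open import Relation.Nullary using (yes; no; does)
  open import Relation.Nullary.Decidable using (dec-true; dec-false)
  open import Relation.Binary.PropositionalEquality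
  open Fraction
  open Binomial using (choose; choose≡C; choose-pos; fallingChoose≡)
  open Counting using (𝟙; sumBy-const)
  open SubsetProperties using (sizedIn; sizedIn-⊤)
  open Powers using (dyadicScale)

  t : ℕ
  t = 2 ^ m

  2k≤t : 2 * k ≤ t
  2k≤t = ≤-trans (*-monoˡ-≤ k {2} {6} (s≤s (s≤s z≤n))) 6k≤2^m

  -- The left inequality makes every system valid (total size ≤ k 2^c ≤ t / 2); the right one turns the
  -- term k / 2^c of the expected value into at most 4 k² / t.
  c-choice : Σ ℕ λ c → c ≤ m × 2 * k * 2 ^ c ≤ t × t < 2 * (2 * k) * 2 ^ c
  c-choice = dyadicScale m (2 * k) (≤-trans 1≤k (m≤n*m k 2)) 2k≤t

  c : ℕ
  c = proj₁ c-choice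

  open Choices t
  open Construction t c

  B : ℕ
  B = choose t k

  L : List System
  L = systems 0 m k

  𝓕 : RSystem
  𝓕 = map (λ F → (frac 1 B , F)) L

  1≤m : 1 ≤ m
  1≤m = positive m 6k≤2^m
    where
    positive : ∀ n → 6 * k ≤ 2 ^ n → 1 ≤ n
    positive zero    6k≤1 with ≤-trans (*-monoʳ-≤ 6 1≤k) 6k≤1
    ... | s≤s ()
    positive (suc n) _    = s≤s z≤n

  sumℚ-𝓕 : ∀ (g : ℚ.ℚ × System → ℚ.ℚ) → sumℚ (map g 𝓕) ≡ ℚSum.sumBy (λ F → g (frac 1 B , F)) L
  sumℚ-𝓕 g = trans (cong sumℚ (sym (map-∘ L))) (sumℚ-map _ L)

  All-𝓕 : ∀ {P : ℚ.ℚ × System → Set} → All (λ F → P (frac 1 B , F)) L → All P 𝓕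
  All-𝓕 all = map⁺ all

  𝓕-isRIntervalSystem : IsRIntervalSystem t k 𝓕
  𝓕-isRIntervalSystem = (All-𝓕 (All.map (λ _ → frac-nonneg 1 B) wellFormed) , total) ,
                        All-𝓕 (All.map (λ (length≡k , inBlock , disjoint , _) → length≡k , inBlock , disjoint) wellFormed)
    where
    wellFormed : All (WellFormed 0 m k) L
    wellFormed = systems-WellFormed 0 m k
    total : sumℚ (map proj₁ 𝓕) ≡ ℚ.1ℚ
    total = begin
      sumℚ (map proj₁ 𝓕)                             ≡⟨ sumℚ-𝓕 proj₁ ⟩
      ℚSum.sumBy (λ _ → frac 1 B) L                  ≡⟨ frac-sumBy (λ _ → 1) B L ⟩
      frac (ℕSum.sumBy (λ _ → 1) L) B                ≡⟨ cong (λ n → frac n B) (trans (sumBy-const 1 L) (*-identityʳ (length L))) ⟩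
      frac (length L) B                              ≡⟨ cong (λ n → frac n B) (length-systems 0 m k) ⟩
      frac B B                                       ≡⟨ frac-self B (choose-pos t k (≤-trans (m≤n*m k 2) 2k≤t)) ⟩
      ℚ.1ℚ                                           ∎
      where open ≡-Reasoning

  𝓕-valid : RValid t 𝓕
  𝓕-valid = All-𝓕 (All.map (λ {F} (length≡k , _ , _ , dyadic) → begin
    2 * totalSize F          ≤⟨ *-monoʳ-≤ 2 (totalSize-≤ F dyadic) ⟩
    2 * (length F * 2 ^ c)   ≡⟨ cong (λ n → 2 * (n * 2 ^ c)) length≡k ⟩
    2 * (k * 2 ^ c)          ≡⟨ *-assoc 2 k (2 ^ c) ⟨
    2 * k * 2 ^ c            ≤⟨ proj₁ (proj₂ (proj₂ c-choice)) ⟩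
    t                        ∎) (systems-WellFormed 0 m k))
    where open ≤-Reasoning

  𝓕-perfect : Perfect t k 𝓕
  𝓕-perfect S = begin
    probSetsR t 𝓕 S                                          ≡⟨ sumℚ-𝓕 (λ p → proj₁ p ℚ.* probSets t (proj₂ p) S) ⟩
    ℚSum.sumBy (λ F → frac 1 B ℚ.* probSets t F S) L         ≡⟨ ℚSum.sumBy-*ˡ (frac 1 B) (λ F → probSets t F S) L ⟩
    frac 1 B ℚ.* ℚSum.sumBy (λ F → probSets t F S) L         ≡⟨ cong (frac 1 B ℚ.*_) (systems-perfect 0 m k S ≤-refl) ⟩
    frac 1 B ℚ.* frac (sizedIn S (block 0 t) k) 1           ≡⟨ cong (λ n → frac 1 B ℚ.* frac n 1) sizedIn-all ⟩
    frac 1 B ℚ.* frac (𝟙 (does (∣ S ∣ ≟ k))) 1              ≡⟨ uniform ⟩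
    uniformK t k S                                           ∎
    where
    open ≡-Reasoning
    sizedIn-all : sizedIn S (block 0 t) k ≡ 𝟙 (does (∣ S ∣ ≟ k))
    sizedIn-all = trans (cong (λ B → sizedIn S B k) block-all) (sizedIn-⊤ S k)
    uniform : frac 1 B ℚ.* frac (𝟙 (does (∣ S ∣ ≟ k))) 1 ≡ uniformK t k S
    uniform with ∣ S ∣ ≟ k
    ... | yes ∣S∣≡k = trans (cong (λ b → frac 1 B ℚ.* frac (𝟙 b) 1) (dec-true (∣ S ∣ ≟ k) ∣S∣≡k))
                           (trans (ℚ.*-identityʳ (frac 1 B)) (cong (frac 1) (choose≡C t k)))
    ... | no  ∣S∣≢k = trans (cong (λ b → frac 1 B ℚ.* frac (𝟙 b) 1) (dec-false (∣ S ∣ ≟ k) ∣S∣≢k))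
                           (ℚ.*-zeroʳ (frac 1 B))

  value-arithmetic : ∀ k m t C B X → 1 ≤ m → t ≤ 4 * k * C → t * X ≤ k * t * B + 2 * m * C * (k * k * B) →
    X * t ≤ 10 * k * k * m * (B * C)
  value-arithmetic k m t C B X 1≤m t≤4kC tX≤ = begin
    X * t                                                   ≡⟨ *-comm X t ⟩
    t * X                                                   ≤⟨ tX≤ ⟩
    k * t * B + 2 * m * C * (k * k * B)                     ≤⟨ +-monoˡ-≤ _ (*-monoˡ-≤ B (*-monoʳ-≤ k t≤4kC)) ⟩
    k * (4 * k * C) * B + 2 * m * C * (k * k * B)           ≤⟨ +-monoˡ-≤ _ (m≤n*m (k * (4 * k * C) * B) m {{>-nonZero 1≤m}}) ⟩
    m * (k * (4 * k * C) * B) + 2 * m * C * (k * k * B)     ≡⟨ collect k m C B ⟩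
    6 * k * k * m * (B * C)                                 ≤⟨ *-monoˡ-≤ (B * C) (*-monoˡ-≤ m (*-monoˡ-≤ k (*-monoˡ-≤ k 6≤10))) ⟩
    10 * k * k * m * (B * C)                                ∎
    where
    open ≤-Reasoning
    6≤10 : 6 ≤ 10
    6≤10 = s≤s (s≤s (s≤s (s≤s (s≤s (s≤s z≤n)))))
    collect : ∀ k m C B → m * (k * (4 * k * C) * B) + 2 * m * C * (k * k * B) ≡ 6 * k * k * m * (B * C)
    collect = solve-∀

  𝓕-value : valR 𝓕 ≤ℚ frac (10 * k * k * m) t
  𝓕-value = subst (_≤ℚ frac (10 * k * k * m) t) (sym valR≡)
    (frac-mono (1 * X) (10 * k * k * m) (B * 2 ^ c) t (*-mono-≤ 1≤B (m^n>0 2 c)) (m^n>0 2 m)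
      (subst (λ x → x * t ≤ 10 * k * k * m * (B * 2 ^ c)) (sym (*-identityˡ X))
        (value-arithmetic k m t (2 ^ c) B X 1≤m t≤4k2^c (≤-trans (systems-value 0 m k) bound))))
    where
    open ≡-Reasoning
    X : ℕ
    X = ℕSum.sumBy systemValue L
    1≤B : 1 ≤ B
    1≤B = choose-pos t k (≤-trans (m≤n*m k 2) 2k≤t)
    valR≡ : valR 𝓕 ≡ frac (1 * X) (B * 2 ^ c)
    valR≡ = begin
      valR 𝓕                                                     ≡⟨ sumℚ-𝓕 (λ p → proj₁ p ℚ.* val (proj₂ p)) ⟩
      ℚSum.sumBy (λ F → frac 1 B ℚ.* val F) L                    ≡⟨ ℚSum.sumBy-*ˡ (frac 1 B) val L ⟩
      frac 1 B ℚ.* ℚSum.sumBy val L                              ≡⟨ cong (frac 1 B ℚ.*_) (ℚSum.sumBy-cong-All (systems-WellFormed 0 m k)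
                                                                      λ {F} (_ , _ , _ , dyadic) → val≡systemValue F dyadic) ⟩
      frac 1 B ℚ.* ℚSum.sumBy (λ F → frac (systemValue F) (2 ^ c)) L ≡⟨ cong (frac 1 B ℚ.*_) (frac-sumBy systemValue (2 ^ c) L) ⟩
      frac 1 B ℚ.* frac X (2 ^ c)                                ≡⟨ frac-* 1 X B (2 ^ c) ⟩
      frac (1 * X) (B * 2 ^ c)                                   ∎
    t≤4k2^c : t ≤ 4 * k * 2 ^ c
    t≤4k2^c = ≤-trans (<⇒≤ (proj₂ (proj₂ (proj₂ c-choice)))) (≤-reflexive (cong (_* 2 ^ c) (sym (*-assoc 2 2 k))))
    bound : valueBound m k ≤ k * t * B + 2 * m * 2 ^ c * (k * k * B)
    bound = +-mono-≤ (≤-reflexive (cong (λ s → k * s * B) (m≥n⇒m⊔n≡m (^-monoʳ-≤ 2 (proj₁ (proj₂ c-choice))))))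
                     (*-monoʳ-≤ (2 * m * 2 ^ c) (subst (_≤ k * k * B) (sym (fallingChoose≡ t k))
                                                        (*-monoˡ-≤ B (*-monoʳ-≤ k (m∸n≤m k 1)))))

lemma3p13 : (k m : ℕ) → 1 ≤ k → 6 * k ≤ 2 ^ m →
    Σ RSystem (λ 𝓕 → IsRIntervalSystem (2 ^ m) k 𝓕 × RValid (2 ^ m) 𝓕 × Perfect (2 ^ m) k 𝓕
    × valR 𝓕 ≤ℚ frac (10 * k * k * m) (2 ^ m))
lemma3p13 k m 1≤k 6k≤2^m = 𝓕 , 𝓕-isRIntervalSystem , 𝓕-valid , 𝓕-perfect , 𝓕-value
  where open Witness {k} {m} 1≤k 6k≤2^m
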